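{- In each of the following cases there is no APS$(v,\alpha,\beta)$ for any nonzero $\alpha,\beta\in\mathbb{Z}_v$: (1) $v\equiv 3\pmod{12}$ and $v=3^{2a}v_1$ with $a\ge1$ and $3\nmid v_1$; (2) $v\equiv 15\pmod{36}$ and $v=3p_1p_2\cdots p_s$, where the $p_i$ are distinct primes with $p_i\equiv\pm3\pmod 8$ for each $i$; (3) $v\equiv 7,11\pmod{12}$ and $v=p_1p_2\cdots p_t$, where the $p_i$ are distinct primes with $p_i\equiv\pm3\pmod 8$ for each $i$.
   Context: APS$(v,\alpha,\beta)$ ($v\equiv3\pmod4$, $\alpha,\beta$ nonzero in $\mathbb{Z}_v$): a set $\mathcal S$ of $(v-3)/4$ unordered pairs $\{x,y\}$ from $\mathbb{Z}_v$ with $\bigcup_{\{x,y\}\in\mathcal S}\pm\{x,y\}=\mathbb{Z}_v\setminus\{0,\pm\alpha\}$ and $\bigcup_{\{x,y\}\in\mathcal S}\pm\{x-y,x+y\}=\mathbb{Z}_v\setminus\{0,\pm\beta\}$. -}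

module Defs where

open import Data.Nat using (ℕ; zero; suc; _+_; _*_; _∸_; _^_; _≥_; NonZero)
open import Data.Nat.DivMod using (_%_; _/_; m%n<n)
open import Data.Nat.Divisibility using (_∣_)
open import Data.Nat.Primality using (Prime)
open import Data.Fin using (Fin; toℕ; fromℕ<)
open import Data.List using (List)
open import Data.Nat.ListAction using (product)
open import Data.List.Relation.Unary.All using (All)
open import Data.List.Relation.Unary.Unique.Propositional using (Unique)
open import Data.Product using (Σ; _×_; _,_; proj₁; proj₂; ∃)
open import Data.Sum using (_⊎_)
open import Relation.Binary.PropositionalEquality using (_≡_; _≢_)
open import Relation.Nullary using (¬_)

module Zmod (v : ℕ) .{{_ : NonZero v}} where
  Zv : Set
  Zv = Fin v

  ι : ℕ → Zv
  ι n = fromℕ< (m%n<n n v)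

  0ᶻ : Zv
  0ᶻ = ι 0

  -_ : Zv → Zv
  - x = ι (v ∸ toℕ x)

  _+ᶻ_ : Zv → Zv → Zv
  x +ᶻ y = ι (toℕ x + toℕ y)

  _-ᶻ_ : Zv → Zv → Zv
  x -ᶻ y = x +ᶻ (- y)

  _∈±_ : Zv → Zv × Zv → Set
  z ∈± (x , y) = z ≡ x ⊎ z ≡ - x ⊎ z ≡ y ⊎ z ≡ - y

  SamePair : Zv × Zv → Zv × Zv → Set
  SamePair (a , b) (c , d) = (a ≡ c × b ≡ d) ⊎ (a ≡ d × b ≡ c)

  -- APS(v, α, β): a set of (v-3)/4 unordered pairs {x,y} (given as an
  -- injective family, injective up to equality of unordered pairs) such that
  --   ⋃ ±{x,y}      = ℤ_v ∖ {0, ±α}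
  --   ⋃ ±{x-y, x+y} = ℤ_v ∖ {0, ±β}
  record APS (α β : Zv) : Set where
    field
      S        : Fin ((v ∸ 3) / 4) → Zv × Zv
      distinct : ∀ i j → SamePair (S i) (S j) → i ≡ j
      cover₁   : ∀ z → (Σ (Fin ((v ∸ 3) / 4)) λ i → z ∈± S i)
                       → (z ≢ 0ᶻ × z ≢ α × z ≢ - α)
      cover₁'  : ∀ z → (z ≢ 0ᶻ × z ≢ α × z ≢ - α)
                       → (Σ (Fin ((v ∸ 3) / 4)) λ i → z ∈± S i)
      cover₂   : ∀ z → (Σ (Fin ((v ∸ 3) / 4)) λ i →
                          z ∈± (proj₁ (S i) -ᶻ proj₂ (S i) , proj₁ (S i) +ᶻ proj₂ (S i)))
                       → (z ≢ 0ᶻ × z ≢ β × z ≢ - β)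
      cover₂'  : ∀ z → (z ≢ 0ᶻ × z ≢ β × z ≢ - β)
                       → (Σ (Fin ((v ∸ 3) / 4)) λ i →
                          z ∈± (proj₁ (S i) -ᶻ proj₂ (S i) , proj₁ (S i) +ᶻ proj₂ (S i)))

open Zmod public

PlusMinus3Mod8 : ℕ → Set
PlusMinus3Mod8 p = p % 8 ≡ 3 ⊎ p % 8 ≡ 5

DistinctPrimesPM3 : List ℕ → Set
DistinctPrimesPM3 ps = Unique ps × All Prime ps × All PlusMinus3Mod8 ps

Case1 : ℕ → Set
Case1 v = v % 12 ≡ 3 × ∃ λ a → ∃ λ v₁ → a ≥ 1 × ¬ (3 ∣ v₁) × v ≡ 3 ^ (2 * a) * v₁

Case2 : ℕ → Set
Case2 v = v % 36 ≡ 15 × ∃ λ ps → DistinctPrimesPM3 ps × v ≡ 3 * product ps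

Case3 : ℕ → Set
Case3 v = (v % 12 ≡ 7 ⊎ v % 12 ≡ 11) × ∃ λ ps → DistinctPrimesPM3 ps × v ≡ product ps

-- Sum the squares of the least nonnegative representatives over ℤ_v in two ways: by the first
-- cover ℤ_v = {0, ±α} ∪ ⋃ ±{x, y}, and by the second, where (x - y)² + (x + y)² = 2(x² + y²).
-- Eliminating the sum over the pairs gives S + 2β² ≡ 4α² (mod v), with S = Σ_{z<v} z² and
-- 6S = (v - 1)v(2v - 1). For a prime p ∣ v with p ≡ ±3 (mod 8) and p ≠ 3 this becomes
-- β² ≡ 2α² (mod p), and as 2 is a non-residue (Gauss's lemma) p divides both α and β.
-- In case (3) this forces α = 0. In case (2) α and β are multiples of v/3 prime to 3, and
-- counting the multiples of 3 in both covers gives v/3 ≡ 1 (mod 12), against v ≡ 15 (mod 36).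
-- In case (1) S ≡ 2v/3 (mod v), and a 3-adic descent on 2v/3 + 2β² ≡ 4α² (mod 9^a)
-- forces 3 ∣ v₁.

module Submission where

open import Data.Nat as ℕ using (ℕ; zero; suc; NonZero; _≤_; _<_; z≤n; s≤s; _∸_; _^_)
import Data.Nat.Properties as ℕₚ
open import Data.Nat.DivMod
  using (_%_; _/_; m%n<n; m≡m%n+[m/n]*n; m<n⇒m%n≡m; [m+kn]%n≡m%n; m*n/n≡m; m∣n⇒o%n%m≡o%m; %-distribˡ-+; %-distribˡ-*)
open import Data.Nat.Divisibility as ℕ∣ using (_∣_; divides; quotient; >⇒∤; ∣⇒≤; _∣?_; m%n≡0⇒n∣m; n∣m⇒m%n≡0)
open import Data.Nat.Primality using (Prime; prime?; euclidsLemma; prime⇒nonZero; prime⇒irreducible; ¬prime[1])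
open import Data.Nat.ListAction using (sum; product)
open import Data.Nat.ListAction.Properties using (sum-↭; sum-++; product-↭; product-++)
import Data.Nat.Tactic.RingSolver as ℕ-Solver
open import Data.Fin using (Fin; toℕ; _≟_)
import Data.Fin.Properties as Finₚ
open import Data.Integer as ℤ using (ℤ; +_; _+_; _-_; _*_; -1ℤ)
import Data.Integer.Properties as ℤₚ
open import Data.Integer.Divisibility.Signed as ℤ∣ using (∣ᵤ⇒∣; ∣⇒∣ᵤ; ∣m∣n⇒∣m+n; ∣m⇒∣m*n; ∣n⇒∣m*n; ∣m⇒∣-m) renaming (_∣_ to _∣ℤ_)
open import Data.Integer.Tactic.RingSolver using (solve-∀)
open import Data.List using (List; []; _∷_; _++_; length; map; applyUpTo; tabulate; allFin)
import Data.List.Properties as Listₚ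
open import Data.List.Membership.Propositional using (_∈_)
open import Data.List.Membership.Propositional.Properties
  using (∈-∃++; ∈-++⁻; ∈-++⁺ˡ; ∈-++⁺ʳ; ∈-applyUpTo⁺; ∈-applyUpTo⁻; ∈-allFin)
open import Data.List.Relation.Unary.Any using (here; there)
open import Data.List.Relation.Unary.All as All using (All; _∷_)
open import Data.List.Relation.Unary.AllPairs using (_∷_)
open import Data.List.Relation.Unary.Unique.Propositional using (Unique)
import Data.List.Relation.Unary.Unique.Propositional.Properties as Unique
open import Data.List.Relation.Binary.Permutation.Propositional using (_↭_; ↭-refl; ↭-trans; ↭-sym; prep)
import Data.List.Relation.Binary.Permutation.Propositional.Properties as ↭
open import Data.Product using (Σ; Σ-syntax; _×_; _,_; proj₁; proj₂)
open import Data.Sum using (_⊎_; inj₁; inj₂)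
open import Data.Empty using (⊥-elim)
open import Data.Unit using (tt)
open import Function using (_∘_; _∘′_)
open import Relation.Binary.Bundles using (Setoid)
open import Relation.Binary.Structures using (IsEquivalence)
import Relation.Binary.Reasoning.Setoid
open import Relation.Binary.PropositionalEquality
open import Relation.Nullary using (¬_; yes; no)
open import Relation.Nullary.Decidable using (toWitness; decidable-stable)
open import Defs using (module Zmod; PlusMinus3Mod8; Case1; Case2; Case3)

unique∧⊆∧length≤⇒↭ : ∀ {A : Set} (xs ys : List A) → Unique xs →
                      (∀ {x} → x ∈ xs → x ∈ ys) → length ys ≤ length xs → xs ↭ ys
unique∧⊆∧length≤⇒↭ [] [] _ _ _ = ↭-refl
unique∧⊆∧length≤⇒↭ (x ∷ xs) ys (x∉xs ∷ xs!) xs⊆ys len with ∈-∃++ (xs⊆ys (here refl))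
... | l , r , refl = ↭-trans (prep x xs↭l++r) (↭-sym (↭.shift x l r))
  where
  xs⊆l++r : ∀ {y} → y ∈ xs → y ∈ l ++ r
  xs⊆l++r y∈xs with ∈-++⁻ l (xs⊆ys (there y∈xs))
  ... | inj₁ y∈l         = ∈-++⁺ˡ y∈l
  ... | inj₂ (here refl) = ⊥-elim (All.lookup x∉xs y∈xs refl)
  ... | inj₂ (there y∈r) = ∈-++⁺ʳ l y∈r
  length-l++r : length (l ++ x ∷ r) ≡ suc (length (l ++ r))
  length-l++r = trans (Listₚ.length-++ l) (trans (ℕₚ.+-suc (length l) (length r)) (cong suc (sym (Listₚ.length-++ l))))
  xs↭l++r : xs ↭ l ++ r
  xs↭l++r = unique∧⊆∧length≤⇒↭ xs (l ++ r) xs! xs⊆l++r (ℕ.s≤s⁻¹ (subst (_≤ suc (length xs)) length-l++r len))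

∣∧<⇒≡0 : ∀ {n m} → n ∣ m → m < n → m ≡ 0
∣∧<⇒≡0 {m = zero}  _   _   = refl
∣∧<⇒≡0 {m = suc _} n∣m m<n = ⊥-elim (>⇒∤ m<n n∣m)

module Congruence (n : ℕ) where

  infix 4 _≈_
  record _≈_ (a b : ℤ) : Set where
    constructor mk
    field divides-difference : + n ∣ℤ a - b
  open _≈_ public

  private
    via : ∀ {x y} → x ≡ y → + n ∣ℤ x → + n ∣ℤ y
    via = subst (+ n ∣ℤ_)

  ≈-refl : ∀ {a} → a ≈ a
  ≈-refl {a} = mk (ℤ∣.divides (+ 0) (lemma a (+ n)))
    where lemma : ∀ a m → a - a ≡ + 0 * m
          lemma = solve-∀

  ≈-reflexive : ∀ {a b} → a ≡ b → a ≈ b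
  ≈-reflexive refl = ≈-refl

  ≈-sym : ∀ {a b} → a ≈ b → b ≈ a
  ≈-sym {a} {b} (mk d) = mk (via (lemma a b) (∣m⇒∣-m d))
    where lemma : ∀ a b → ℤ.- (a - b) ≡ b - a
          lemma = solve-∀

  ≈-trans : ∀ {a b c} → a ≈ b → b ≈ c → a ≈ c
  ≈-trans {a} {b} {c} (mk d) (mk e) = mk (via (lemma a b c) (∣m∣n⇒∣m+n d e))
    where lemma : ∀ a b c → (a - b) + (b - c) ≡ a - c
          lemma = solve-∀

  ≈-isEquivalence : IsEquivalence _≈_
  ≈-isEquivalence = record { refl = ≈-refl ; sym = ≈-sym ; trans = ≈-trans }

  ≈-setoid : Setoid _ _
  ≈-setoid = record { isEquivalence = ≈-isEquivalence }

  module ≈-Reasoning = Relation.Binary.Reasoning.Setoid ≈-setoid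

  +-cong : ∀ {a b c d} → a ≈ b → c ≈ d → a + c ≈ b + d
  +-cong {a} {b} {c} {d} (mk x) (mk y) = mk (via (lemma a b c d) (∣m∣n⇒∣m+n x y))
    where lemma : ∀ a b c d → (a - b) + (c - d) ≡ (a + c) - (b + d)
          lemma = solve-∀

  +-congˡ : ∀ c {a b} → a ≈ b → c + a ≈ c + b
  +-congˡ c = +-cong (≈-refl {c})

  +-congʳ : ∀ c {a b} → a ≈ b → a + c ≈ b + c
  +-congʳ c a≈b = +-cong a≈b (≈-refl {c})

  *-cong : ∀ {a b c d} → a ≈ b → c ≈ d → a * c ≈ b * d
  *-cong {a} {b} {c} {d} (mk x) (mk y) = mk (via (lemma a b c d) (∣m∣n⇒∣m+n (∣m⇒∣m*n c x) (∣n⇒∣m*n b y)))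
    where lemma : ∀ a b c d → (a - b) * c + b * (c - d) ≡ (a * c) - (b * d)
          lemma = solve-∀

  *-congˡ : ∀ c {a b} → a ≈ b → c * a ≈ c * b
  *-congˡ c = *-cong (≈-refl {c})

  -‿cong : ∀ {a b} → a ≈ b → ℤ.- a ≈ ℤ.- b
  -‿cong {a} {b} (mk x) = mk (via (lemma a b) (∣m⇒∣-m x))
    where lemma : ∀ a b → ℤ.- (a - b) ≡ (ℤ.- a) - (ℤ.- b)
          lemma = solve-∀

  ≈⇒-≈0 : ∀ {a b} → a ≈ b → a - b ≈ + 0
  ≈⇒-≈0 {a} {b} a≈b = ≈-trans (+-congʳ (ℤ.- b) a≈b) (≈-reflexive (ℤₚ.+-inverseʳ b))

  n*≈0 : ∀ a → + n * a ≈ + 0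
  n*≈0 a = mk (ℤ∣.divides a (lemma a (+ n)))
    where lemma : ∀ a n → n * a - + 0 ≡ a * n
          lemma = solve-∀

  ∣⇒≈0 : ∀ {m} → n ∣ m → + m ≈ + 0
  ∣⇒≈0 {m} d = mk (∣ᵤ⇒∣ (subst (n ∣_) (cong ℤ.∣_∣ (sym (ℤₚ.+-identityʳ (+ m)))) d))

  ≈0⇒∣ : ∀ {m} → + m ≈ + 0 → n ∣ m
  ≈0⇒∣ {m} (mk d) = subst (n ∣_) (cong ℤ.∣_∣ (ℤₚ.+-identityʳ (+ m))) (∣⇒∣ᵤ d)

  pos-^-cong : ∀ {x y} k → + x ≈ + y → + (x ℕ.^ k) ≈ + (y ℕ.^ k)
  pos-^-cong zero e = ≈-refl
  pos-^-cong {x} {y} (suc k) e =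
    subst₂ _≈_ (sym (ℤₚ.pos-* x _)) (sym (ℤₚ.pos-* y _)) (*-cong e (pos-^-cong k e))

  module _ .{{_ : NonZero n}} where

    %-≈ : ∀ m → + (m % n) ≈ + m
    %-≈ m = mk (ℤ∣.divides (ℤ.- + (m / n)) (trans (cong (λ z → + (m % n) - z) m≡r+qn) (lemma (+ (m % n)) (+ (m / n)) (+ n))))
      where
      m≡r+qn : + m ≡ + (m % n) + + (m / n) * + n
      m≡r+qn = trans (cong +_ (m≡m%n+[m/n]*n m n))
                     (trans (ℤₚ.pos-+ (m % n) _) (cong (λ z → + (m % n) + z) (ℤₚ.pos-* (m / n) n)))
      lemma : ∀ r q m → r - (r + q * m) ≡ (ℤ.- q) * m
      lemma = solve-∀

    private
      ≤-injective : ∀ {i j} → i ≤ j → j < n → + j ≈ + i → i ≡ j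
      ≤-injective {i} {j} i≤j j<n e = begin
          i                ≡⟨ sym (ℕₚ.+-identityʳ i) ⟩
          i ℕ.+ 0          ≡⟨ cong (i ℕ.+_) (sym (∣∧<⇒≡0 n∣j∸i (ℕₚ.≤-<-trans (ℕₚ.m∸n≤m j i) j<n))) ⟩
          i ℕ.+ (j ∸ i)    ≡⟨ ℕₚ.m+[n∸m]≡n i≤j ⟩
          j                ∎
        where
        open ≡-Reasoning
        lemma : ∀ a b → a + b - a ≡ b - + 0
        lemma = solve-∀
        j-i≡j∸i : + j - + i ≡ + (j ∸ i) - + 0
        j-i≡j∸i = trans (cong (λ z → + z - + i) (sym (ℕₚ.m+[n∸m]≡n i≤j)))
                        (trans (cong (_- + i) (ℤₚ.pos-+ i (j ∸ i))) (lemma (+ i) (+ (j ∸ i))))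
        n∣j∸i : n ∣ (j ∸ i)
        n∣j∸i = ≈0⇒∣ (mk (via j-i≡j∸i (divides-difference e)))

    <⇒≈-injective : ∀ {i j} → i < n → j < n → + i ≈ + j → i ≡ j
    <⇒≈-injective {i} {j} i<n j<n e with ℕₚ.≤-total i j
    ... | inj₁ i≤j = ≤-injective i≤j j<n (≈-sym e)
    ... | inj₂ j≤i = sym (≤-injective j≤i i<n e)

    ≈⇒%-≡ : ∀ {u w} → + u ≈ + w → u % n ≡ w % n
    ≈⇒%-≡ {u} {w} e = <⇒≈-injective (m%n<n u n) (m%n<n w n) (≈-trans (%-≈ u) (≈-trans e (≈-sym (%-≈ w))))

    ∸-≈-neg : ∀ {t} → t ≤ n → + (n ∸ t) ≈ ℤ.- + t
    ∸-≈-neg {t} t≤n = mk (ℤ∣.divides (+ 1) (begin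
        + (n ∸ t) - ℤ.- + t ≡⟨ lemma (+ (n ∸ t)) (+ t) ⟩
        + (n ∸ t) + + t     ≡⟨ ℤₚ.pos-+ (n ∸ t) t ⟨
        + (n ∸ t ℕ.+ t)     ≡⟨ cong +_ (ℕₚ.m∸n+n≡m t≤n) ⟩
        + n                 ≡⟨ ℤₚ.*-identityˡ (+ n) ⟨
        + 1 * + n           ∎))
      where
      open ≡-Reasoning
      lemma : ∀ a b → a - (ℤ.- b) ≡ a + b
      lemma = solve-∀

≈-mod-∣ : ∀ {d n a b} → d ∣ n → Congruence._≈_ n a b → Congruence._≈_ d a b
≈-mod-∣ {d} {n} d∣n e = Congruence.mk (ℤ∣.∣-trans (∣ᵤ⇒∣ {+ d} {+ n} d∣n) (Congruence.divides-difference e))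

≈-cancel-scale : ∀ c {n a b} .{{_ : NonZero c}} →
                 Congruence._≈_ (c ℕ.* n) (+ c * a) (+ c * b) → Congruence._≈_ n a b
≈-cancel-scale c {n} {a} {b} (Congruence.mk cn∣ca-cb) =
  Congruence.mk (ℤ∣.*-cancelˡ-∣ (+ c) (subst₂ _∣ℤ_ (ℤₚ.pos-* c n) (lemma (+ c) a b) cn∣ca-cb))
  where lemma : ∀ c a b → c * a - c * b ≡ c * (a - b)
        lemma = solve-∀

prodUpTo : (ℕ → ℕ) → ℕ → ℕ
prodUpTo f n = product (applyUpTo f n)

prodUpTo-scale : ∀ a f n → prodUpTo (λ k → a ℕ.* f k) n ≡ a ^ n ℕ.* prodUpTo f n
prodUpTo-scale a f zero    = refl
prodUpTo-scale a f (suc n) =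
  trans (cong (a ℕ.* f 0 ℕ.*_) (prodUpTo-scale a (f ∘ suc) n)) (lemma a (f 0) (a ^ n) (prodUpTo (f ∘ suc) n))
  where lemma : ∀ a b x q → (a ℕ.* b) ℕ.* (x ℕ.* q) ≡ (a ℕ.* x) ℕ.* (b ℕ.* q)
        lemma = ℕ-Solver.solve-∀

prodUpTo-split : ∀ f q m → prodUpTo f (q ℕ.+ m) ≡ prodUpTo f q ℕ.* prodUpTo (λ k → f (q ℕ.+ k)) m
prodUpTo-split f zero    m = sym (ℕₚ.*-identityˡ _)
prodUpTo-split f (suc q) m =
  trans (cong (f 0 ℕ.*_) (prodUpTo-split (f ∘ suc) q m)) (sym (ℕₚ.*-assoc (f 0) _ _))

^-distribʳ-* : ∀ m n k → (m ℕ.* n) ^ k ≡ m ^ k ℕ.* n ^ k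
^-distribʳ-* m n zero    = refl
^-distribʳ-* m n (suc k) = trans (cong (m ℕ.* n ℕ.*_) (^-distribʳ-* m n k)) (lemma m n (m ^ k) (n ^ k))
  where lemma : ∀ m n a b → (m ℕ.* n) ℕ.* (a ℕ.* b) ≡ (m ℕ.* a) ℕ.* (n ℕ.* b)
        lemma = ℕ-Solver.solve-∀

-1^odd : ∀ j → -1ℤ ℤ.^ suc (j ℕ.+ j) ≡ -1ℤ
-1^odd zero    = refl
-1^odd (suc j) = begin
  -1ℤ ℤ.^ suc (suc j ℕ.+ suc j)      ≡⟨ cong (λ k → -1ℤ ℤ.^ suc (suc k)) (ℕₚ.+-suc j j) ⟩
  -1ℤ * (-1ℤ * -1ℤ ℤ.^ suc (j ℕ.+ j)) ≡⟨ lemma (-1ℤ ℤ.^ suc (j ℕ.+ j)) ⟩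
  -1ℤ ℤ.^ suc (j ℕ.+ j)              ≡⟨ -1^odd j ⟩
  -1ℤ                                ∎
  where
  open ≡-Reasoning
  lemma : ∀ x → -1ℤ * (-1ℤ * x) ≡ x
  lemma = solve-∀

PlusMinus3Mod8⇒∤2 : ∀ {n} → PlusMinus3Mod8 n → ¬ n ∣ 2
PlusMinus3Mod8⇒∤2 {n} n≡±3 n∣2 with ∣⇒≤ n∣2
PlusMinus3Mod8⇒∤2 {1} (inj₁ ()) _ | _
PlusMinus3Mod8⇒∤2 {1} (inj₂ ()) _ | _
PlusMinus3Mod8⇒∤2 {2} (inj₁ ()) _ | _
PlusMinus3Mod8⇒∤2 {2} (inj₂ ()) _ | _
PlusMinus3Mod8⇒∤2 {suc (suc (suc _))} _ _ | s≤s (s≤s ())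

module PrimeModulus (p : ℕ) (p-prime : Prime p) where
  open Congruence p

  instance
    p-nonZero : NonZero p
    p-nonZero = prime⇒nonZero p-prime

  *-cancelʳ-≈ : ∀ {a b} c → ¬ p ∣ c → a * + c ≈ b * + c → a ≈ b
  *-cancelʳ-≈ {a} {b} c p∤c (mk d) with euclidsLemma ℤ.∣ a - b ∣ c p-prime p∣[a-b]c
    where
    lemma : ∀ a b c → a * c - b * c ≡ (a - b) * c
    lemma = solve-∀
    p∣[a-b]c : p ∣ ℤ.∣ a - b ∣ ℕ.* c
    p∣[a-b]c = subst (p ∣_) (trans (cong ℤ.∣_∣ (lemma a b (+ c))) (ℤₚ.abs-* (a - b) (+ c))) (∣⇒∣ᵤ d)
  ... | inj₁ p∣a-b = mk (∣ᵤ⇒∣ p∣a-b)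
  ... | inj₂ p∣c   = ⊥-elim (p∤c p∣c)

  ∤-product : ∀ xs → (∀ {x} → x ∈ xs → ¬ p ∣ x) → ¬ p ∣ product xs
  ∤-product []       _   p∣1 = ¬prime[1] (subst Prime (ℕ∣.∣1⇒≡1 p∣1) p-prime)
  ∤-product (x ∷ xs) p∤xs p∣ with euclidsLemma x (product xs) p-prime p∣
  ... | inj₁ p∣x  = p∤xs (here refl) p∣x
  ... | inj₂ p∣xs = ∤-product xs (p∤xs ∘ there) p∣xs

  ∤-prodUpTo-suc : ∀ n → n < p → ¬ p ∣ prodUpTo suc n
  ∤-prodUpTo-suc n n<p = ∤-product (applyUpTo suc n) p∤
    where p∤ : ∀ {x} → x ∈ applyUpTo suc n → ¬ p ∣ x
          p∤ x∈ with ∈-applyUpTo⁻ suc x∈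
          ... | k , k<n , refl = λ p∣ → ℕₚ.<⇒≱ (ℕₚ.≤-<-trans k<n n<p) (∣⇒≤ p∣)

  prodUpTo-cong : ∀ f g n → (∀ k → + f k ≈ + g k) → + prodUpTo f n ≈ + prodUpTo g n
  prodUpTo-cong f g zero    f≈g = ≈-refl
  prodUpTo-cong f g (suc n) f≈g = subst₂ _≈_ (sym (ℤₚ.pos-* (f 0) _)) (sym (ℤₚ.pos-* (g 0) _))
    (*-cong (f≈g 0) (prodUpTo-cong (f ∘ suc) (g ∘ suc) n (f≈g ∘ suc)))

  prodUpTo-negate : ∀ f g n → (∀ k → k < n → + f k ≈ ℤ.- + g k) →
                    + prodUpTo f n ≈ -1ℤ ℤ.^ n * + prodUpTo g n
  prodUpTo-negate f g zero    _   = ≈-sym (≈-reflexive (ℤₚ.*-identityˡ _))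
  prodUpTo-negate f g (suc n) f≈-g = subst₂ _≈_ (sym (ℤₚ.pos-* (f 0) _))
    (trans (lemma (+ g 0) (-1ℤ ℤ.^ n) (+ prodUpTo (g ∘ suc) n)) (cong (-1ℤ ℤ.^ suc n *_) (sym (ℤₚ.pos-* (g 0) _))))
    (*-cong (f≈-g 0 (s≤s z≤n)) (prodUpTo-negate (f ∘ suc) (g ∘ suc) n (λ k k<n → f≈-g (suc k) (s≤s k<n))))
    where lemma : ∀ a s b → (ℤ.- a) * (s * b) ≡ (-1ℤ * s) * (a * b)
          lemma = solve-∀

  p-1 : ℕ
  p-1 = ℕ.pred p

  private
    <p-1⇒suc<p : ∀ {k} → k < p-1 → suc k < p
    <p-1⇒suc<p = ℕₚ.m≤pred[n]⇒suc[m]≤n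

  module _ (a : ℕ) (p∤a : ¬ p ∣ a) where

    private
      residue : ℕ → ℕ
      residue k = (a ℕ.* suc k) % p

      residue≢0 : ∀ {k} → k < p-1 → residue k ≢ 0
      residue≢0 {k} k<p-1 r≡0 with euclidsLemma a (suc k) p-prime (ℕ∣.m%n≡0⇒n∣m _ p r≡0)
      ... | inj₁ p∣a  = p∤a p∣a
      ... | inj₂ p∣1+k = ℕₚ.<⇒≱ (<p-1⇒suc<p k<p-1) (∣⇒≤ p∣1+k)

      residue-injective : ∀ {i j} → i < j → j < p-1 → residue i ≢ residue j
      residue-injective {i} {j} i<j j<p-1 eq =
        ℕₚ.<⇒≢ i<j (ℕₚ.suc-injective (<⇒≈-injective (<p-1⇒suc<p (ℕₚ.<-trans i<j j<p-1)) (<p-1⇒suc<p j<p-1) 1+i≈1+j))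
        where
        swap : ∀ k → + (a ℕ.* k) ≡ + k * + a
        swap k = trans (ℤₚ.pos-* a k) (ℤₚ.*-comm (+ a) (+ k))
        a[1+i]≈a[1+j] : + (a ℕ.* suc i) ≈ + (a ℕ.* suc j)
        a[1+i]≈a[1+j] = ≈-trans (≈-sym (%-≈ _)) (≈-trans (≈-reflexive (cong +_ eq)) (%-≈ _))
        1+i≈1+j : + suc i ≈ + suc j
        1+i≈1+j = *-cancelʳ-≈ a p∤a (subst₂ _≈_ (swap (suc i)) (swap (suc j)) a[1+i]≈a[1+j])

    residues-↭ : applyUpTo residue p-1 ↭ applyUpTo suc p-1
    residues-↭ = unique∧⊆∧length≤⇒↭ _ _ (Unique.applyUpTo⁺₁ residue p-1 residue-injective) ⊆ length≤
      where
      ⊆ : ∀ {x} → x ∈ applyUpTo residue p-1 → x ∈ applyUpTo suc p-1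
      ⊆ x∈ with ∈-applyUpTo⁻ residue x∈
      ... | k , k<p-1 , refl with residue k | residue≢0 k<p-1 | m%n<n (a ℕ.* suc k) p
      ...   | zero  | r≢0 | _   = ⊥-elim (r≢0 refl)
      ...   | suc r | _   | r<p = ∈-applyUpTo⁺ suc (ℕₚ.suc[m]≤n⇒m≤pred[n] r<p)
      length≤ : length (applyUpTo suc p-1) ≤ length (applyUpTo residue p-1)
      length≤ = ℕₚ.≤-reflexive (trans (Listₚ.length-applyUpTo suc p-1) (sym (Listₚ.length-applyUpTo residue p-1)))

    fermat : + (a ^ p-1) ≈ + 1
    fermat = *-cancelʳ-≈ (prodUpTo suc p-1) (∤-prodUpTo-suc p-1 (ℕₚ.m≤pred[n]⇒suc[m]≤n ℕₚ.≤-refl)) (begin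
      + (a ^ p-1) * + prodUpTo suc p-1  ≡⟨ ℤₚ.pos-* (a ^ p-1) _ ⟨
      + (a ^ p-1 ℕ.* prodUpTo suc p-1)  ≡⟨ cong +_ (prodUpTo-scale a suc p-1) ⟨
      + prodUpTo (λ k → a ℕ.* suc k) p-1 ≈⟨ prodUpTo-cong residue _ p-1 (λ k → %-≈ (a ℕ.* suc k)) ⟨
      + prodUpTo residue p-1           ≡⟨ cong +_ (product-↭ residues-↭) ⟩
      + prodUpTo suc p-1               ≡⟨ ℤₚ.*-identityˡ _ ⟨
      + 1 * + prodUpTo suc p-1         ∎)
      where open ≈-Reasoning

  module _ {h q μ : ℕ} (p≡1+2h : p ≡ suc (2 ℕ.* h)) (h≡q+μ : h ≡ q ℕ.+ μ)
           (2q≤h : 2 ℕ.* q ≤ h) (h≤1+2q : h ≤ suc (2 ℕ.* q)) where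

    private
      even : ℕ → ℕ
      even k = 2 ℕ.* suc k

      bigEven : ℕ → ℕ
      bigEven k = even (q ℕ.+ k)

      reflected : ℕ → ℕ
      reflected k = p ∸ bigEven k

      2h<p : 2 ℕ.* h < p
      2h<p = ℕₚ.≤-reflexive (sym p≡1+2h)

      1+q+k≤h : ∀ {k} → k < μ → suc (q ℕ.+ k) ≤ h
      1+q+k≤h {k} k<μ = subst (suc (q ℕ.+ k) ≤_) (sym h≡q+μ)
                              (subst (_≤ q ℕ.+ μ) (ℕₚ.+-suc q k) (ℕₚ.+-monoʳ-≤ q k<μ))

      bigEven<p : ∀ {k} → k < μ → bigEven k < p
      bigEven<p k<μ = ℕₚ.≤-<-trans (ℕₚ.*-monoʳ-≤ 2 (1+q+k≤h k<μ)) 2h<p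

      h<bigEven : ∀ k → h < bigEven k
      h<bigEven k = ℕₚ.≤-trans (s≤s h≤1+2q)
        (ℕₚ.≤-trans (ℕₚ.≤-reflexive (sym (ℕₚ.*-suc 2 q))) (ℕₚ.*-monoʳ-≤ 2 (s≤s (ℕₚ.m≤m+n q k))))

      reflected≤h : ∀ {k} → k < μ → reflected k ≤ h
      reflected≤h {k} k<μ = ℕₚ.m≤n+o⇒m∸n≤o p (bigEven k) (subst (_≤ bigEven k ℕ.+ h) (sym p≡1+2h)
        (subst (_≤ bigEven k ℕ.+ h) (cong suc (cong (h ℕ.+_) (sym (ℕₚ.+-identityʳ h)))) (ℕₚ.+-monoˡ-≤ h (h<bigEven k))))

      ∈1-to-h : ∀ y → 0 < y → y ≤ h → y ∈ applyUpTo suc h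
      ∈1-to-h (suc y) _ y<h = ∈-applyUpTo⁺ suc y<h

      evens = applyUpTo even q
      reflecteds = applyUpTo reflected μ

      evens-unique : Unique evens
      evens-unique = Unique.applyUpTo⁺₁ even q
        (λ i<j _ eq → ℕₚ.<⇒≢ i<j (ℕₚ.suc-injective (ℕₚ.*-cancelˡ-≡ _ _ 2 eq)))

      reflecteds-unique : Unique reflecteds
      reflecteds-unique = Unique.applyUpTo⁺₁ reflected μ (λ {i} {j} i<j j<μ eq →
        ℕₚ.<⇒≢ i<j (ℕₚ.+-cancelˡ-≡ q _ _ (ℕₚ.suc-injective (ℕₚ.*-cancelˡ-≡ _ _ 2
          (ℕₚ.∸-cancelˡ-≡ (ℕₚ.<⇒≤ (bigEven<p (ℕₚ.<-trans i<j j<μ))) (ℕₚ.<⇒≤ (bigEven<p j<μ)) eq)))))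

      -- An even number and p minus an even number have different parities.
      evens-disjoint-reflecteds : ∀ {y} → ¬ (y ∈ evens × y ∈ reflecteds)
      evens-disjoint-reflecteds (y∈E , y∈R) with ∈-applyUpTo⁻ even y∈E | ∈-applyUpTo⁻ reflected y∈R
      ... | i , _ , refl | k , k<μ , eq = ℕₚ.even≢odd (suc i ℕ.+ suc (q ℕ.+ k)) h
        (trans (ℕₚ.*-distribˡ-+ 2 (suc i) _)
               (trans (cong (ℕ._+ bigEven k) eq) (trans (ℕₚ.m∸n+n≡m (ℕₚ.<⇒≤ (bigEven<p k<μ))) p≡1+2h)))

      halves-↭ : evens ++ reflecteds ↭ applyUpTo suc h
      halves-↭ = unique∧⊆∧length≤⇒↭ _ _
        (Unique.++⁺ evens-unique reflecteds-unique evens-disjoint-reflecteds) ⊆ length≤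
        where
        ⊆ : ∀ {y} → y ∈ evens ++ reflecteds → y ∈ applyUpTo suc h
        ⊆ y∈ with ∈-++⁻ evens y∈
        ... | inj₁ y∈E with ∈-applyUpTo⁻ even y∈E
        ...   | k , k<q , refl = ∈1-to-h (even k) (s≤s z≤n) (ℕₚ.≤-trans (ℕₚ.*-monoʳ-≤ 2 k<q) 2q≤h)
        ⊆ y∈ | inj₂ y∈R with ∈-applyUpTo⁻ reflected y∈R
        ...   | k , k<μ , refl = ∈1-to-h (reflected k) (ℕₚ.m<n⇒0<n∸m (bigEven<p k<μ)) (reflected≤h k<μ)
        length≤ : length (applyUpTo suc h) ≤ length (evens ++ reflecteds)
        length≤ = ℕₚ.≤-reflexive (trans (Listₚ.length-applyUpTo suc h) (trans h≡q+μ (sym (trans (Listₚ.length-++ evens)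
                    (cong₂ ℕ._+_ (Listₚ.length-applyUpTo even q) (Listₚ.length-applyUpTo reflected μ))))))

    gauss-lemma-2 : -1ℤ ℤ.^ μ * + (2 ^ h) ≈ + 1
    gauss-lemma-2 = ≈-sym (*-cancelʳ-≈ h! (∤-prodUpTo-suc h (ℕₚ.≤-<-trans (ℕₚ.m≤n*m h 2) 2h<p)) (begin
      + 1 * + h!                                               ≡⟨ ℤₚ.*-identityˡ _ ⟩
      + h!                                                     ≡⟨ cong +_ (product-↭ halves-↭) ⟨
      + product (evens ++ reflecteds)                          ≡⟨ cong +_ (product-++ evens reflecteds) ⟩
      + (product evens ℕ.* product reflecteds)                 ≡⟨ ℤₚ.pos-* (product evens) _ ⟩
      + product evens * + product reflecteds                   ≈⟨ *-congˡ (+ product evens) (prodUpTo-negate reflected bigEven μ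
                                                                    (λ k k<μ → ∸-≈-neg (ℕₚ.<⇒≤ (bigEven<p k<μ)))) ⟩
      + product evens * (-1ℤ ℤ.^ μ * + prodUpTo bigEven μ)     ≡⟨ lemma (+ product evens) (-1ℤ ℤ.^ μ) _ ⟩
      -1ℤ ℤ.^ μ * (+ product evens * + prodUpTo bigEven μ)     ≡⟨ cong (-1ℤ ℤ.^ μ *_) (ℤₚ.pos-* (product evens) _) ⟨
      -1ℤ ℤ.^ μ * + (product evens ℕ.* prodUpTo bigEven μ)     ≡⟨ cong (λ z → -1ℤ ℤ.^ μ * + z) 2^h*h! ⟩
      -1ℤ ℤ.^ μ * + (2 ^ h ℕ.* h!)                             ≡⟨ cong (-1ℤ ℤ.^ μ *_) (ℤₚ.pos-* (2 ^ h) h!) ⟩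
      -1ℤ ℤ.^ μ * (+ (2 ^ h) * + h!)                           ≡⟨ ℤₚ.*-assoc (-1ℤ ℤ.^ μ) _ _ ⟨
      -1ℤ ℤ.^ μ * + (2 ^ h) * + h!                             ∎))
      where
      open ≈-Reasoning
      h! = prodUpTo suc h
      lemma : ∀ a s b → a * (s * b) ≡ s * (a * b)
      lemma = solve-∀
      2^h*h! : product evens ℕ.* prodUpTo bigEven μ ≡ 2 ^ h ℕ.* h!
      2^h*h! = trans (sym (prodUpTo-split even q μ)) (trans (cong (prodUpTo even) (sym h≡q+μ)) (prodUpTo-scale 2 suc h))

  private
    -- p = 8r + 3 gives h = 4r + 1 = 2r + (2r + 1); p = 8r + 5 gives h = 4r + 2 = (2r + 1) + (2r + 1)
    gauss-split : PlusMinus3Mod8 p → Σ[ h ∈ ℕ ] Σ[ q ∈ ℕ ] Σ[ j ∈ ℕ ]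
                  p ≡ suc (2 ℕ.* h) × h ≡ q ℕ.+ suc (j ℕ.+ j) × 2 ℕ.* q ≤ h × h ≤ suc (2 ℕ.* q)
    gauss-split (inj₁ p%8≡3) = 4 ℕ.* r ℕ.+ 1 , 2 ℕ.* r , r ,
        trans (m≡m%n+[m/n]*n p 8) (trans (cong (ℕ._+ r ℕ.* 8) p%8≡3) (lemma₁ r)) , lemma₂ r ,
        ℕₚ.≤-trans (ℕₚ.n≤1+n _) (ℕₚ.≤-reflexive (sym (lemma₃ r))) , ℕₚ.≤-reflexive (lemma₃ r)
      where
      r = p / 8
      lemma₁ : ∀ r → 3 ℕ.+ r ℕ.* 8 ≡ suc (2 ℕ.* (4 ℕ.* r ℕ.+ 1))
      lemma₁ = ℕ-Solver.solve-∀
      lemma₂ : ∀ r → 4 ℕ.* r ℕ.+ 1 ≡ 2 ℕ.* r ℕ.+ suc (r ℕ.+ r)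
      lemma₂ = ℕ-Solver.solve-∀
      lemma₃ : ∀ r → 4 ℕ.* r ℕ.+ 1 ≡ suc (2 ℕ.* (2 ℕ.* r))
      lemma₃ = ℕ-Solver.solve-∀
    gauss-split (inj₂ p%8≡5) = 4 ℕ.* r ℕ.+ 2 , 2 ℕ.* r ℕ.+ 1 , r ,
        trans (m≡m%n+[m/n]*n p 8) (trans (cong (ℕ._+ r ℕ.* 8) p%8≡5) (lemma₁ r)) , lemma₂ r ,
        ℕₚ.≤-reflexive (lemma₃ r) , subst (_≤ suc (2 ℕ.* (2 ℕ.* r ℕ.+ 1))) (lemma₃ r) (ℕₚ.n≤1+n _)
      where
      r = p / 8
      lemma₁ : ∀ r → 5 ℕ.+ r ℕ.* 8 ≡ suc (2 ℕ.* (4 ℕ.* r ℕ.+ 2))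
      lemma₁ = ℕ-Solver.solve-∀
      lemma₂ : ∀ r → 4 ℕ.* r ℕ.+ 2 ≡ (2 ℕ.* r ℕ.+ 1) ℕ.+ suc (r ℕ.+ r)
      lemma₂ = ℕ-Solver.solve-∀
      lemma₃ : ∀ r → 2 ℕ.* (2 ℕ.* r ℕ.+ 1) ≡ 4 ℕ.* r ℕ.+ 2
      lemma₃ = ℕ-Solver.solve-∀

  PlusMinus3Mod8⇒2^h≈-1 : PlusMinus3Mod8 p → Σ[ h ∈ ℕ ] p ≡ suc (2 ℕ.* h) × + (2 ^ h) ≈ -1ℤ
  PlusMinus3Mod8⇒2^h≈-1 p≡±3 with gauss-split p≡±3
  ... | h , q , j , p≡1+2h , h≡q+μ , 2q≤h , h≤1+2q = h , p≡1+2h , (begin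
    + (2 ^ h)                                  ≡⟨ lemma (+ (2 ^ h)) ⟩
    -1ℤ * (-1ℤ * + (2 ^ h))                    ≡⟨ cong (λ s → -1ℤ * (s * + (2 ^ h))) (-1^odd j) ⟨
    -1ℤ * (-1ℤ ℤ.^ suc (j ℕ.+ j) * + (2 ^ h))  ≈⟨ *-congˡ -1ℤ (gauss-lemma-2 {μ = suc (j ℕ.+ j)} p≡1+2h h≡q+μ 2q≤h h≤1+2q) ⟩
    -1ℤ * + 1                                  ≡⟨⟩
    -1ℤ                                        ∎)
    where
    open ≈-Reasoning
    lemma : ∀ x → x ≡ -1ℤ * (-1ℤ * x)
    lemma = solve-∀

  square≈2*square⇒∣ : PlusMinus3Mod8 p → ∀ a b → + (b ℕ.* b) ≈ + (2 ℕ.* (a ℕ.* a)) → p ∣ a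
  square≈2*square⇒∣ p≡±3 a b b²≈2a² =
    decidable-stable (p ∣? a) (λ p∤a → PlusMinus3Mod8⇒∤2 p≡±3 (≈0⇒∣ {2} (+-congʳ (+ 1) (1≈-1 p∤a))))
    where
    h = proj₁ (PlusMinus3Mod8⇒2^h≈-1 p≡±3)
    p≡1+2h = proj₁ (proj₂ (PlusMinus3Mod8⇒2^h≈-1 p≡±3))
    2^h≈-1 = proj₂ (proj₂ (PlusMinus3Mod8⇒2^h≈-1 p≡±3))
    p∤a⇒p∤b : ¬ p ∣ a → ¬ p ∣ b
    p∤a⇒p∤b p∤a p∣b with euclidsLemma 2 (a ℕ.* a) p-prime (≈0⇒∣ (≈-trans (≈-sym b²≈2a²) (≈-trans (≈-reflexive (ℤₚ.pos-* b b)) (*-cong (∣⇒≈0 p∣b) ≈-refl))))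
    ... | inj₁ p∣2 = PlusMinus3Mod8⇒∤2 p≡±3 p∣2
    ... | inj₂ p∣a² with euclidsLemma a a p-prime p∣a²
    ...   | inj₁ p∣a = p∤a p∣a
    ...   | inj₂ p∣a = p∤a p∣a
    x^p-1≡x²^h : ∀ x → x ^ p-1 ≡ (x ℕ.* x) ^ h
    x^p-1≡x²^h x = begin
      x ^ p-1             ≡⟨ cong (x ^_) (cong ℕ.pred p≡1+2h) ⟩
      x ^ (2 ℕ.* h)       ≡⟨ ℕₚ.^-*-assoc x 2 h ⟨
      (x ^ 2) ^ h         ≡⟨ cong (λ y → (x ℕ.* y) ^ h) (ℕₚ.*-identityʳ x) ⟩
      (x ℕ.* x) ^ h       ∎
      where open ≡-Reasoning
    1≈-1 : ¬ p ∣ a → + 1 ≈ -1ℤ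
    1≈-1 p∤a = begin
      + 1                                ≈⟨ fermat b (p∤a⇒p∤b p∤a) ⟨
      + (b ^ p-1)                        ≡⟨ cong +_ (x^p-1≡x²^h b) ⟩
      + ((b ℕ.* b) ^ h)                  ≈⟨ pos-^-cong h b²≈2a² ⟩
      + ((2 ℕ.* (a ℕ.* a)) ^ h)          ≡⟨ cong +_ (trans (^-distribʳ-* 2 (a ℕ.* a) h) (cong (2 ^ h ℕ.*_) (sym (x^p-1≡x²^h a)))) ⟩
      + (2 ^ h ℕ.* a ^ p-1)              ≡⟨ ℤₚ.pos-* (2 ^ h) _ ⟩
      + (2 ^ h) * + (a ^ p-1)            ≈⟨ *-cong 2^h≈-1 (fermat a p∤a) ⟩
      -1ℤ * + 1                          ≡⟨⟩
      -1ℤ                                ∎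
      where open ≈-Reasoning

sumUpTo : (ℕ → ℕ) → ℕ → ℕ
sumUpTo f n = sum (applyUpTo f n)

sum-tabulate : ∀ n f → sum (tabulate {n = n} (f ∘ toℕ)) ≡ sumUpTo f n
sum-tabulate zero    f = refl
sum-tabulate (suc n) f = cong (f 0 ℕ.+_) (sum-tabulate n (f ∘ suc))

sum-allFin : ∀ n f → sum (map (f ∘ toℕ) (allFin n)) ≡ sumUpTo f n
sum-allFin n f = trans (cong sum (Listₚ.map-tabulate {n = n} (λ i → i) (f ∘ toℕ))) (sum-tabulate n f)

sumUpTo-suc : ∀ f n → sumUpTo f (suc n) ≡ sumUpTo f n ℕ.+ f n
sumUpTo-suc f zero    = ℕₚ.+-comm (f 0) 0
sumUpTo-suc f (suc n) = trans (cong (f 0 ℕ.+_) (sumUpTo-suc (f ∘ suc) n)) (sym (ℕₚ.+-assoc (f 0) _ _))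

6*sumUpTo-squares : ∀ n → 6 ℕ.* sumUpTo (λ k → k ℕ.* k) (suc n) ≡ n ℕ.* suc n ℕ.* suc (2 ℕ.* n)
6*sumUpTo-squares zero    = refl
6*sumUpTo-squares (suc n) = begin
  6 ℕ.* S (suc (suc n))                           ≡⟨ cong (6 ℕ.*_) (sumUpTo-suc (λ k → k ℕ.* k) (suc n)) ⟩
  6 ℕ.* (S (suc n) ℕ.+ suc n ℕ.* suc n)           ≡⟨ ℕₚ.*-distribˡ-+ 6 (S (suc n)) _ ⟩
  6 ℕ.* S (suc n) ℕ.+ 6 ℕ.* (suc n ℕ.* suc n)     ≡⟨ cong (ℕ._+ 6 ℕ.* (suc n ℕ.* suc n)) (6*sumUpTo-squares n) ⟩
  n ℕ.* suc n ℕ.* suc (2 ℕ.* n) ℕ.+ 6 ℕ.* (suc n ℕ.* suc n) ≡⟨ lemma n ⟩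
  suc n ℕ.* suc (suc n) ℕ.* suc (2 ℕ.* suc n)     ∎
  where
  open ≡-Reasoning
  S = sumUpTo (λ k → k ℕ.* k)
  lemma : ∀ n → n ℕ.* suc n ℕ.* suc (2 ℕ.* n) ℕ.+ 6 ℕ.* (suc n ℕ.* suc n) ≡ suc n ℕ.* suc (suc n) ℕ.* suc (2 ℕ.* suc n)
  lemma = ℕ-Solver.solve-∀

n∣6*sumUpTo-squares : ∀ n .{{_ : NonZero n}} → n ∣ 6 ℕ.* sumUpTo (λ k → k ℕ.* k) n
n∣6*sumUpTo-squares (suc n) = divides (n ℕ.* suc (2 ℕ.* n)) (trans (6*sumUpTo-squares n) (lemma n))
  where lemma : ∀ n → n ℕ.* suc n ℕ.* suc (2 ℕ.* n) ≡ n ℕ.* suc (2 ℕ.* n) ℕ.* suc n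
        lemma = ℕ-Solver.solve-∀

isZero : ℕ → ℕ
isZero zero    = 1
isZero (suc _) = 0

isMultipleOf3 : ℕ → ℕ
isMultipleOf3 n = isZero (n % 3)

count-multiplesOf3 : ∀ m → sumUpTo isMultipleOf3 (3 ℕ.* m) ≡ m
count-multiplesOf3 zero    = refl
count-multiplesOf3 (suc m) = begin
  C (3 ℕ.* suc m)                                   ≡⟨ cong C (ℕₚ.*-suc 3 m) ⟩
  C (3 ℕ.+ 3 ℕ.* m)                                 ≡⟨ sumUpTo-suc isMultipleOf3 (2 ℕ.+ 3 ℕ.* m) ⟩
  C (2 ℕ.+ 3 ℕ.* m) ℕ.+ isMultipleOf3 (2 ℕ.+ 3 ℕ.* m) ≡⟨ cong₂ ℕ._+_ (sumUpTo-suc isMultipleOf3 (1 ℕ.+ 3 ℕ.* m)) (residue 2) ⟩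
  C (1 ℕ.+ 3 ℕ.* m) ℕ.+ isMultipleOf3 (1 ℕ.+ 3 ℕ.* m) ℕ.+ 0
    ≡⟨ cong (ℕ._+ 0) (cong₂ ℕ._+_ (sumUpTo-suc isMultipleOf3 (3 ℕ.* m)) (residue 1)) ⟩
  C (3 ℕ.* m) ℕ.+ isMultipleOf3 (3 ℕ.* m) ℕ.+ 0 ℕ.+ 0 ≡⟨ cong (λ s → s ℕ.+ 0 ℕ.+ 0) (cong₂ ℕ._+_ (count-multiplesOf3 m) (residue 0)) ⟩
  m ℕ.+ 1 ℕ.+ 0 ℕ.+ 0                               ≡⟨ lemma m ⟩
  suc m                                             ∎
  where
  open ≡-Reasoning
  C = sumUpTo isMultipleOf3
  residue : ∀ c → isMultipleOf3 (c ℕ.+ 3 ℕ.* m) ≡ isMultipleOf3 c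
  residue c = cong isZero (trans (cong (λ k → (c ℕ.+ k) % 3) (ℕₚ.*-comm 3 m)) ([m+kn]%n≡m%n c m 3))
  lemma : ∀ m → m ℕ.+ 1 ℕ.+ 0 ℕ.+ 0 ≡ suc m
  lemma = ℕ-Solver.solve-∀

sumUpTo-squares-3+12q : ∀ q → sumUpTo (λ k → k ℕ.* k) (3 ℕ.+ q ℕ.* 12) ≡ 2 ℕ.* (4 ℕ.* q ℕ.+ 1) ℕ.+ (48 ℕ.* (q ℕ.* q) ℕ.+ 18 ℕ.* q ℕ.+ 1) ℕ.* (3 ℕ.+ q ℕ.* 12)
sumUpTo-squares-3+12q q = ℕₚ.*-cancelˡ-≡ _ _ 6 (trans (6*sumUpTo-squares (2 ℕ.+ q ℕ.* 12)) (lemma q))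
  where lemma : ∀ q → (2 ℕ.+ q ℕ.* 12) ℕ.* suc (2 ℕ.+ q ℕ.* 12) ℕ.* suc (2 ℕ.* (2 ℕ.+ q ℕ.* 12))
                      ≡ 6 ℕ.* (2 ℕ.* (4 ℕ.* q ℕ.+ 1) ℕ.+ (48 ℕ.* (q ℕ.* q) ℕ.+ 18 ℕ.* q ℕ.+ 1) ℕ.* (3 ℕ.+ q ℕ.* 12))
        lemma = ℕ-Solver.solve-∀

module ResidueSums (v : ℕ) .{{_ : NonZero v}} where
  open Zmod v
  open Congruence v

  toℤ : Zv → ℤ
  toℤ z = + toℕ z

  toℕ-ι : ∀ n → toℕ (ι n) ≡ n % v
  toℕ-ι n = Finₚ.toℕ-fromℕ< _

  toℤ-ι : ∀ n → toℤ (ι n) ≈ + n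
  toℤ-ι n = subst (λ m → + m ≈ + n) (sym (toℕ-ι n)) (%-≈ n)

  toℤ-0 : toℤ 0ᶻ ≈ + 0
  toℤ-0 = toℤ-ι 0

  toℤ-neg : ∀ x → toℤ (- x) ≈ ℤ.- toℤ x
  toℤ-neg x = ≈-trans (toℤ-ι (v ∸ toℕ x)) (∸-≈-neg (ℕₚ.<⇒≤ (Finₚ.toℕ<n x)))

  toℤ-+ : ∀ x y → toℤ (x +ᶻ y) ≈ toℤ x + toℤ y
  toℤ-+ x y = ≈-trans (toℤ-ι _) (≈-reflexive (ℤₚ.pos-+ (toℕ x) (toℕ y)))

  toℤ-- : ∀ x y → toℤ (x -ᶻ y) ≈ toℤ x - toℤ y
  toℤ-- x y = ≈-trans (toℤ-+ x (- y)) (+-congˡ (toℤ x) (toℤ-neg y))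

  ±pair : Zv × Zv → List Zv
  ±pair (x , y) = x ∷ - x ∷ y ∷ - y ∷ []

  sum± : (Zv → ℕ) → Zv × Zv → ℕ
  sum± f xy = sum (map f (±pair xy))

  ∈±⇒∈±pair : ∀ {z} xy → z ∈± xy → z ∈ ±pair xy
  ∈±⇒∈±pair xy (inj₁ refl)                = here refl
  ∈±⇒∈±pair xy (inj₂ (inj₁ refl))         = there (here refl)
  ∈±⇒∈±pair xy (inj₂ (inj₂ (inj₁ refl)))  = there (there (here refl))
  ∈±⇒∈±pair xy (inj₂ (inj₂ (inj₂ refl)))  = there (there (there (here refl)))

  module _ {N : ℕ} (g : Fin N → Zv × Zv) where

    ±pairs : List (Fin N) → List Zv
    ±pairs []       = []
    ±pairs (i ∷ is) = ±pair (g i) ++ ±pairs is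

    length-±pairs : ∀ is → length (±pairs is) ≡ 4 ℕ.* length is
    length-±pairs []       = refl
    length-±pairs (i ∷ is) = trans (cong (4 ℕ.+_) (length-±pairs is)) (sym (ℕₚ.*-suc 4 (length is)))

    ∈-±pairs : ∀ {z i} is → i ∈ is → z ∈ ±pair (g i) → z ∈ ±pairs is
    ∈-±pairs (j ∷ is) (here refl) z∈ = ∈-++⁺ˡ z∈
    ∈-±pairs (j ∷ is) (there i∈)  z∈ = ∈-++⁺ʳ (±pair (g j)) (∈-±pairs is i∈ z∈)

    sum-±pairs : ∀ f is → sum (map f (±pairs is)) ≡ sum (map (sum± f ∘′ g) is)
    sum-±pairs f []       = refl
    sum-±pairs f (i ∷ is) = trans (cong sum (Listₚ.map-++ f (±pair (g i)) (±pairs is)))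
      (trans (sum-++ (map f (±pair (g i))) (map f (±pairs is))) (cong (sum± f (g i) ℕ.+_) (sum-±pairs f is)))

    -- Counting alone forces the 4N + 3 listed elements to be all of ℤ_v, each exactly once.
    sum-over-cover : ∀ (a b c : Zv) → 4 ℕ.* N ℕ.+ 3 ≡ v →
                     (∀ z → z ≢ a × z ≢ b × z ≢ c → Σ (Fin N) λ i → z ∈± g i) →
                     ∀ f → sum (map f (allFin v)) ≡ sum (map (sum± f ∘′ g) (allFin N)) ℕ.+ sum (map f (a ∷ b ∷ c ∷ []))
    sum-over-cover a b c 4N+3≡v cover f = begin
      sum (map f (allFin v))                          ≡⟨ sum-↭ (↭.map⁺ f allFin↭listed) ⟩
      sum (map f (±pairs (allFin N) ++ a ∷ b ∷ c ∷ [])) ≡⟨ cong sum (Listₚ.map-++ f (±pairs (allFin N)) _) ⟩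
      sum (map f (±pairs (allFin N)) ++ _)            ≡⟨ sum-++ (map f (±pairs (allFin N))) _ ⟩
      sum (map f (±pairs (allFin N))) ℕ.+ _            ≡⟨ cong (ℕ._+ _) (sum-±pairs f (allFin N)) ⟩
      sum (map (sum± f ∘′ g) (allFin N)) ℕ.+ _         ∎
      where
      open ≡-Reasoning
      listed = ±pairs (allFin N) ++ a ∷ b ∷ c ∷ []
      ⊆ : ∀ {z} → z ∈ allFin v → z ∈ listed
      ⊆ {z} _ with z ≟ a | z ≟ b | z ≟ c
      ... | yes refl | _        | _        = ∈-++⁺ʳ (±pairs (allFin N)) (here refl)
      ... | no _     | yes refl | _        = ∈-++⁺ʳ (±pairs (allFin N)) (there (here refl))
      ... | no _     | no _     | yes refl = ∈-++⁺ʳ (±pairs (allFin N)) (there (there (here refl)))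
      ... | no z≢a   | no z≢b   | no z≢c with cover z (z≢a , z≢b , z≢c)
      ...   | i , z∈±gi = ∈-++⁺ˡ (∈-±pairs (allFin N) (∈-allFin i) (∈±⇒∈±pair (g i) z∈±gi))
      length≤ : length listed ≤ length (allFin v)
      length≤ = ℕₚ.≤-reflexive (begin
        length listed                        ≡⟨ Listₚ.length-++ (±pairs (allFin N)) ⟩
        length (±pairs (allFin N)) ℕ.+ 3     ≡⟨ cong (ℕ._+ 3) (length-±pairs (allFin N)) ⟩
        4 ℕ.* length (allFin N) ℕ.+ 3        ≡⟨ cong (λ n → 4 ℕ.* n ℕ.+ 3) (Listₚ.length-tabulate {n = N} (λ i → i)) ⟩
        4 ℕ.* N ℕ.+ 3                        ≡⟨ 4N+3≡v ⟩
        v                                    ≡⟨ Listₚ.length-tabulate {n = v} (λ i → i) ⟨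
        length (allFin v)                    ∎)
      allFin↭listed = unique∧⊆∧length≤⇒↭ (allFin v) listed (Unique.allFin⁺ v) ⊆ length≤

module SquareSums (v : ℕ) .{{_ : NonZero v}} where
  open Zmod v
  open Congruence v
  open ResidueSums v

  square : Zv → ℕ
  square z = toℕ z ℕ.* toℕ z

  sumOfSquares : ℕ
  sumOfSquares = sum (map square (allFin v))

  sumOfSquares≈2*[4q+1] : ∀ q → v ≡ 3 ℕ.+ q ℕ.* 12 → + sumOfSquares ≈ + 2 * + (4 ℕ.* q ℕ.+ 1)
  sumOfSquares≈2*[4q+1] q v≡3+12q = begin
    + sumOfSquares                             ≡⟨ cong +_ (trans (sum-allFin v (λ k → k ℕ.* k)) (cong (sumUpTo (λ k → k ℕ.* k)) v≡3+12q)) ⟩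
    + sumUpTo (λ k → k ℕ.* k) (3 ℕ.+ q ℕ.* 12) ≡⟨ cong +_ (sumUpTo-squares-3+12q q) ⟩
    + (2 ℕ.* m ℕ.+ K ℕ.* (3 ℕ.+ q ℕ.* 12))     ≡⟨ cong (λ n → + (2 ℕ.* m ℕ.+ K ℕ.* n)) v≡3+12q ⟨
    + (2 ℕ.* m ℕ.+ K ℕ.* v)                    ≡⟨ trans (ℤₚ.pos-+ (2 ℕ.* m) _) (cong₂ _+_ (ℤₚ.pos-* 2 m) (trans (ℤₚ.pos-* K v) (ℤₚ.*-comm (+ K) (+ v)))) ⟩
    + 2 * + m + + v * + K                      ≈⟨ +-congˡ (+ 2 * + m) (n*≈0 (+ K)) ⟩
    + 2 * + m + + 0                            ≡⟨ ℤₚ.+-identityʳ _ ⟩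
    + 2 * + m                                  ∎
    where
    open ≈-Reasoning
    m = 4 ℕ.* q ℕ.+ 1
    K = 48 ℕ.* (q ℕ.* q) ℕ.+ 18 ℕ.* q ℕ.+ 1

  toℤ² : Zv → ℤ
  toℤ² z = toℤ z * toℤ z

  private
    square-≈ : ∀ z {w} → toℤ z ≈ w → + square z ≈ w * w
    square-≈ z e = ≈-trans (≈-reflexive (ℤₚ.pos-* (toℕ z) (toℕ z))) (*-cong e e)

    +-sum : ∀ m n → + (m ℕ.+ n) ≈ + m + + n
    +-sum m n = ≈-reflexive (ℤₚ.pos-+ m n)

    +-sum₃ : ∀ a b c → + sum (a ∷ b ∷ c ∷ []) ≡ + a + (+ b + + c)
    +-sum₃ a b c = trans (ℤₚ.pos-+ a _) (cong (ℤ._+_ (+ a)) (trans (ℤₚ.pos-+ b _) (cong (ℤ._+_ (+ b)) (cong +_ (ℕₚ.+-identityʳ c)))))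

    +-sum₄ : ∀ a b c d → + sum (a ∷ b ∷ c ∷ d ∷ []) ≡ + a + (+ b + (+ c + + d))
    +-sum₄ a b c d = trans (ℤₚ.pos-+ a _) (cong (ℤ._+_ (+ a)) (+-sum₃ b c d))

  sum±-squares : ∀ x y → + sum± square (x , y) ≈ + 2 * (toℤ² x + toℤ² y)
  sum±-squares x y = begin
    + sum± square (x , y)                                         ≡⟨ +-sum₄ (square x) (square (- x)) (square y) (square (- y)) ⟩
    + square x + (+ square (- x) + (+ square y + + square (- y)))
      ≈⟨ +-cong (square-≈ x ≈-refl) (+-cong (square-≈ (- x) (toℤ-neg x)) (+-cong (square-≈ y ≈-refl) (square-≈ (- y) (toℤ-neg y)))) ⟩
    toℤ² x + (ℤ.- toℤ x * ℤ.- toℤ x + (toℤ² y + ℤ.- toℤ y * ℤ.- toℤ y))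
      ≡⟨ lemma (toℤ x) (toℤ y) ⟩
    + 2 * (toℤ² x + toℤ² y)                                       ∎
    where
    open ≈-Reasoning
    lemma : ∀ a b → a * a + (ℤ.- a * ℤ.- a + (b * b + ℤ.- b * ℤ.- b)) ≡ + 2 * (a * a + b * b)
    lemma = solve-∀

  sum±-squares-of-differences : ∀ x y → + sum± square (x -ᶻ y , x +ᶻ y) ≈ + 4 * (toℤ² x + toℤ² y)
  sum±-squares-of-differences x y = begin
    + sum± square (x -ᶻ y , x +ᶻ y)                                       ≈⟨ sum±-squares (x -ᶻ y) (x +ᶻ y) ⟩
    + 2 * (toℤ² (x -ᶻ y) + toℤ² (x +ᶻ y))
      ≈⟨ *-congˡ (+ 2) (+-cong (*-cong (toℤ-- x y) (toℤ-- x y)) (*-cong (toℤ-+ x y) (toℤ-+ x y))) ⟩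
    + 2 * ((toℤ x - toℤ y) * (toℤ x - toℤ y) + (toℤ x + toℤ y) * (toℤ x + toℤ y)) ≡⟨ lemma (toℤ x) (toℤ y) ⟩
    + 4 * (toℤ² x + toℤ² y)                                               ∎
    where
    open ≈-Reasoning
    lemma : ∀ a b → + 2 * ((a - b) * (a - b) + (a + b) * (a + b)) ≡ + 4 * (a * a + b * b)
    lemma = solve-∀

  sum-squares-0±a : ∀ a → + sum (map square (0ᶻ ∷ a ∷ - a ∷ [])) ≈ + 2 * toℤ² a
  sum-squares-0±a a = begin
    + sum (map square (0ᶻ ∷ a ∷ - a ∷ []))                        ≡⟨ +-sum₃ (square 0ᶻ) (square a) (square (- a)) ⟩
    + square 0ᶻ + (+ square a + + square (- a))
      ≈⟨ +-cong (square-≈ 0ᶻ toℤ-0) (+-cong (square-≈ a ≈-refl) (square-≈ (- a) (toℤ-neg a))) ⟩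
    + 0 * + 0 + (toℤ² a + ℤ.- toℤ a * ℤ.- toℤ a)                        ≡⟨ lemma (toℤ a) ⟩
    + 2 * toℤ² a                                                       ∎
    where
    open ≈-Reasoning
    lemma : ∀ a → + 0 * + 0 + (a * a + ℤ.- a * ℤ.- a) ≡ + 2 * (a * a)
    lemma = solve-∀

  sum-≈-scaled : ∀ {A : Set} (f t : A → ℕ) c xs → (∀ x → + f x ≈ c * + t x) →
                 + sum (map f xs) ≈ c * + sum (map t xs)
  sum-≈-scaled f t c []       _    = ≈-reflexive (sym (ℤₚ.*-zeroʳ c))
  sum-≈-scaled f t c (x ∷ xs) f≈ct = begin
    + (f x ℕ.+ sum (map f xs))          ≈⟨ +-sum (f x) _ ⟩
    + f x + + sum (map f xs)            ≈⟨ +-cong (f≈ct x) (sum-≈-scaled f t c xs f≈ct) ⟩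
    c * + t x + c * + sum (map t xs)    ≡⟨ ℤₚ.*-distribˡ-+ c (+ t x) _ ⟨
    c * (+ t x + + sum (map t xs))      ≡⟨ cong (c *_) (ℤₚ.pos-+ (t x) _) ⟨
    c * + sum (map t (x ∷ xs))        ∎
    where open ≈-Reasoning

  module _ {α β : Zv} (A : APS α β) (4N+3≡v : 4 ℕ.* ((v ∸ 3) / 4) ℕ.+ 3 ≡ v) where
    open APS A

    private
      N = (v ∸ 3) / 4

      x y : Fin N → Zv
      x i = proj₁ (S i)
      y i = proj₂ (S i)

      differences : Fin N → Zv × Zv
      differences i = x i -ᶻ y i , x i +ᶻ y i

      pairSquares : ℤ
      pairSquares = + sum (map (λ i → square (x i) ℕ.+ square (y i)) (allFin N))

      toℤ²-+ : ∀ i → toℤ² (x i) + toℤ² (y i) ≡ + (square (x i) ℕ.+ square (y i))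
      toℤ²-+ i = sym (trans (ℤₚ.pos-+ (square (x i)) _) (cong₂ _+_ (ℤₚ.pos-* (toℕ (x i)) _) (ℤₚ.pos-* (toℕ (y i)) _)))

      sumOfSquares≈ : ∀ (g : Fin N → Zv × Zv) c γ → (∀ i → + sum± square (g i) ≈ + c * (toℤ² (x i) + toℤ² (y i))) →
                      (∀ z → z ≢ 0ᶻ × z ≢ γ × z ≢ - γ → Σ (Fin N) λ i → z ∈± g i) →
                      + sumOfSquares ≈ + c * pairSquares + + 2 * toℤ² γ
      sumOfSquares≈ g c γ sum±≈ cover = begin
        + sumOfSquares                                           ≡⟨ cong +_ (sum-over-cover g 0ᶻ γ (- γ) 4N+3≡v cover square) ⟩
        + (sum (map (sum± square ∘′ g) (allFin N)) ℕ.+ sum (map square (0ᶻ ∷ γ ∷ - γ ∷ [])))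
                                                                 ≡⟨ ℤₚ.pos-+ (sum (map (sum± square ∘′ g) (allFin N))) _ ⟩
        + sum (map (sum± square ∘′ g) (allFin N)) + + sum (map square (0ᶻ ∷ γ ∷ - γ ∷ []))
          ≈⟨ +-cong (sum-≈-scaled _ _ (+ c) (allFin N) (λ i → ≈-trans (sum±≈ i) (≈-reflexive (cong (+ c *_) (toℤ²-+ i)))))
                    (sum-squares-0±a γ) ⟩
        + c * pairSquares + + 2 * toℤ² γ                         ∎
        where open ≈-Reasoning

    -- Twice the first sum minus the second eliminates the unknown sum over the pairs.
    APS⇒sumOfSquares≈ : + sumOfSquares + + 2 * toℤ² β ≈ + 4 * toℤ² α
    APS⇒sumOfSquares≈ = begin
      + sumOfSquares + + 2 * toℤ² β                             ≡⟨ lemma₁ (+ sumOfSquares) (toℤ² β) ⟩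
      + 2 * + sumOfSquares + (ℤ.- + sumOfSquares + + 2 * toℤ² β)
        ≈⟨ +-cong (*-congˡ (+ 2) (sumOfSquares≈ S 2 α (λ i → sum±-squares (x i) (y i)) cover₁'))
                  (+-cong (-‿cong (sumOfSquares≈ differences 4 β (λ i → sum±-squares-of-differences (x i) (y i)) cover₂'))
                          ≈-refl) ⟩
      + 2 * (+ 2 * pairSquares + + 2 * toℤ² α) + (ℤ.- (+ 4 * pairSquares + + 2 * toℤ² β) + + 2 * toℤ² β)
                                                                 ≡⟨ lemma₂ pairSquares (toℤ² α) (toℤ² β) ⟩
      + 4 * toℤ² α                                               ∎
      where
      open ≈-Reasoning
      lemma₁ : ∀ T b → T + + 2 * b ≡ + 2 * T + (ℤ.- T + + 2 * b)
      lemma₁ = solve-∀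
      lemma₂ : ∀ P a b → + 2 * (+ 2 * P + + 2 * a) + (ℤ.- (+ 4 * P + + 2 * b) + + 2 * b) ≡ + 4 * a
      lemma₂ = solve-∀

multiplesOf3In± : ℕ → ℕ → ℕ
multiplesOf3In± r s = isZero r ℕ.+ (isZero ((2 ℕ.* r) % 3) ℕ.+ (isZero s ℕ.+ (isZero ((2 ℕ.* s) % 3) ℕ.+ 0)))

-- For residues r, s of x, y: the multiples of 3 among ±x, ±y and among ±(x - y), ±(x + y)
-- together number 8 if r = s = 0 and 2 otherwise.
multiplesOf3In±-pairs : ∀ r s → r < 3 → s < 3 →
  Σ[ e ∈ ℕ ] multiplesOf3In± r s ℕ.+ multiplesOf3In± ((r ℕ.+ 2 ℕ.* s) % 3) ((r ℕ.+ s) % 3) ≡ 2 ℕ.+ 6 ℕ.* e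
multiplesOf3In±-pairs 0 0 _ _ = 1 , refl
multiplesOf3In±-pairs 0 1 _ _ = 0 , refl
multiplesOf3In±-pairs 0 2 _ _ = 0 , refl
multiplesOf3In±-pairs 1 0 _ _ = 0 , refl
multiplesOf3In±-pairs 1 1 _ _ = 0 , refl
multiplesOf3In±-pairs 1 2 _ _ = 0 , refl
multiplesOf3In±-pairs 2 0 _ _ = 0 , refl
multiplesOf3In±-pairs 2 1 _ _ = 0 , refl
multiplesOf3In±-pairs 2 2 _ _ = 0 , refl
multiplesOf3In±-pairs (suc (suc (suc _))) _ (s≤s (s≤s (s≤s ()))) _
multiplesOf3In±-pairs 0 (suc (suc (suc _))) _ (s≤s (s≤s (s≤s ())))
multiplesOf3In±-pairs 1 (suc (suc (suc _))) _ (s≤s (s≤s (s≤s ())))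
multiplesOf3In±-pairs 2 (suc (suc (suc _))) _ (s≤s (s≤s (s≤s ())))

multiplesOf3In±-nonzero : ∀ r → r < 3 → r ≢ 0 → isZero r ℕ.+ (isZero ((2 ℕ.* r) % 3) ℕ.+ 0) ≡ 0
multiplesOf3In±-nonzero 0 _ r≢0 = ⊥-elim (r≢0 refl)
multiplesOf3In±-nonzero 1 _ _   = refl
multiplesOf3In±-nonzero 2 _ _   = refl
multiplesOf3In±-nonzero (suc (suc (suc _))) (s≤s (s≤s (s≤s ()))) _

sum-+-≡2+6* : ∀ {A : Set} (f g e : A → ℕ) xs → (∀ x → f x ℕ.+ g x ≡ 2 ℕ.+ 6 ℕ.* e x) →
              sum (map f xs) ℕ.+ sum (map g xs) ≡ 2 ℕ.* length xs ℕ.+ 6 ℕ.* sum (map e xs)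
sum-+-≡2+6* f g e []       _ = refl
sum-+-≡2+6* f g e (x ∷ xs) f+g≡2+6e =
  trans (lemma₁ (f x) (g x) (sum (map f xs)) (sum (map g xs)))
        (trans (cong₂ ℕ._+_ (f+g≡2+6e x) (sum-+-≡2+6* f g e xs f+g≡2+6e)) (lemma₂ (e x) (length xs) (sum (map e xs))))
  where
  lemma₁ : ∀ a b c d → (a ℕ.+ c) ℕ.+ (b ℕ.+ d) ≡ (a ℕ.+ b) ℕ.+ (c ℕ.+ d)
  lemma₁ = ℕ-Solver.solve-∀
  lemma₂ : ∀ a l s → (2 ℕ.+ 6 ℕ.* a) ℕ.+ (2 ℕ.* l ℕ.+ 6 ℕ.* s) ≡ 2 ℕ.* suc l ℕ.+ 6 ℕ.* (a ℕ.+ s)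
  lemma₂ = ℕ-Solver.solve-∀

counts⇒≡1[mod12] : ∀ m s₁ s₂ N E → s₁ ℕ.+ 1 ≡ m → s₂ ℕ.+ 1 ≡ m → s₁ ℕ.+ s₂ ≡ 2 ℕ.* N ℕ.+ 6 ℕ.* E →
            4 ℕ.* N ℕ.+ 3 ≡ 3 ℕ.* m → m % 12 ≡ 1
counts⇒≡1[mod12] m s₁ s₂ N E s₁+1≡m s₂+1≡m s₁+s₂≡2N+6E 4N+3≡3m =
  trans (cong (_% 12) m≡1+12E) ([m+kn]%n≡m%n 1 E 12)
  where
  s₁≡N+3E : s₁ ≡ N ℕ.+ 3 ℕ.* E
  s₁≡N+3E = ℕₚ.*-cancelˡ-≡ s₁ _ 2 (trans (trans (lemma₁ s₁) (cong (s₁ ℕ.+_) (ℕₚ.+-cancelʳ-≡ 1 s₁ s₂ (trans s₁+1≡m (sym s₂+1≡m)))))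
                                        (trans s₁+s₂≡2N+6E (lemma₂ N E)))
    where lemma₁ : ∀ s → 2 ℕ.* s ≡ s ℕ.+ s
          lemma₁ = ℕ-Solver.solve-∀
          lemma₂ : ∀ N E → 2 ℕ.* N ℕ.+ 6 ℕ.* E ≡ 2 ℕ.* (N ℕ.+ 3 ℕ.* E)
          lemma₂ = ℕ-Solver.solve-∀
  N≡9E : N ≡ 9 ℕ.* E
  N≡9E = ℕₚ.+-cancelˡ-≡ (3 ℕ.* N ℕ.+ 3) N (9 ℕ.* E)
           (trans (lemma₁ N) (trans 4N+3≡3m (trans (cong (3 ℕ.*_) (trans (sym s₁+1≡m) (cong (ℕ._+ 1) s₁≡N+3E))) (lemma₂ N E))))
    where lemma₁ : ∀ N → (3 ℕ.* N ℕ.+ 3) ℕ.+ N ≡ 4 ℕ.* N ℕ.+ 3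
          lemma₁ = ℕ-Solver.solve-∀
          lemma₂ : ∀ N E → 3 ℕ.* (N ℕ.+ 3 ℕ.* E ℕ.+ 1) ≡ (3 ℕ.* N ℕ.+ 3) ℕ.+ 9 ℕ.* E
          lemma₂ = ℕ-Solver.solve-∀
  m≡1+12E : m ≡ 1 ℕ.+ E ℕ.* 12
  m≡1+12E = trans (sym s₁+1≡m) (trans (cong (ℕ._+ 1) (trans s₁≡N+3E (cong (ℕ._+ 3 ℕ.* E) N≡9E))) (lemma E))
    where lemma : ∀ E → 9 ℕ.* E ℕ.+ 3 ℕ.* E ℕ.+ 1 ≡ 1 ℕ.+ E ℕ.* 12
          lemma = ℕ-Solver.solve-∀

module ResiduesMod3 (v : ℕ) .{{_ : NonZero v}} (3∣v : 3 ∣ v) where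
  open Zmod v
  open ResidueSums v
  open Congruence 3

  residue : Zv → ℕ
  residue z = toℕ z % 3

  private
    from-mod-v : ∀ {a b} → Congruence._≈_ v a b → a ≈ b
    from-mod-v = ≈-mod-∣ 3∣v

    residue-≈ : ∀ {z n} → toℤ z ≈ + n → residue z ≡ n % 3
    residue-≈ = ≈⇒%-≡

    neg-≈ : ∀ a → ℤ.- + a ≈ + (2 ℕ.* (a % 3))
    neg-≈ a = begin
      ℤ.- + a              ≈⟨ mk (ℤ∣.divides (ℤ.- + a) (lemma (+ a))) ⟩
      + 2 * + a            ≈⟨ *-congˡ (+ 2) (%-≈ a) ⟨
      + 2 * + (a % 3)      ≡⟨ ℤₚ.pos-* 2 (a % 3) ⟨
      + (2 ℕ.* (a % 3))    ∎
      where
      open ≈-Reasoning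
      lemma : ∀ a → ℤ.- a - + 2 * a ≡ ℤ.- a * + 3
      lemma = solve-∀

  residue-neg : ∀ x → residue (- x) ≡ (2 ℕ.* residue x) % 3
  residue-neg x = residue-≈ (≈-trans (from-mod-v (toℤ-neg x)) (neg-≈ (toℕ x)))

  residue-+ : ∀ x y → residue (x +ᶻ y) ≡ (residue x ℕ.+ residue y) % 3
  residue-+ x y = residue-≈ (≈-trans (from-mod-v (toℤ-+ x y))
    (≈-trans (+-cong (≈-sym (%-≈ (toℕ x))) (≈-sym (%-≈ (toℕ y)))) (≈-reflexive (sym (ℤₚ.pos-+ (residue x) _)))))

  residue-- : ∀ x y → residue (x -ᶻ y) ≡ (residue x ℕ.+ 2 ℕ.* residue y) % 3
  residue-- x y = residue-≈ (≈-trans (from-mod-v (toℤ-- x y))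
    (≈-trans (+-cong (≈-sym (%-≈ (toℕ x))) (neg-≈ (toℕ y))) (≈-reflexive (sym (ℤₚ.pos-+ (residue x) _)))))

  residue-0 : residue 0ᶻ ≡ 0
  residue-0 = cong (_% 3) (trans (toℕ-ι 0) (m<n⇒m%n≡m (ℕ.>-nonZero⁻¹ v)))

  sum±-multiplesOf3 : ∀ x y → sum± (isMultipleOf3 ∘ toℕ) (x , y) ≡ multiplesOf3In± (residue x) (residue y)
  sum±-multiplesOf3 x y = cong₂ (λ a b → isZero (residue x) ℕ.+ (isZero a ℕ.+ (isZero (residue y) ℕ.+ (isZero b ℕ.+ 0))))
                                (residue-neg x) (residue-neg y)

  sum±-multiplesOf3-differences : ∀ x y → sum± (isMultipleOf3 ∘ toℕ) (x -ᶻ y , x +ᶻ y) ≡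
    multiplesOf3In± ((residue x ℕ.+ 2 ℕ.* residue y) % 3) ((residue x ℕ.+ residue y) % 3)
  sum±-multiplesOf3-differences x y =
    trans (sum±-multiplesOf3 (x -ᶻ y) (x +ᶻ y)) (cong₂ multiplesOf3In± (residue-- x y) (residue-+ x y))

  multiplesOf3-0±a : ∀ a → ¬ 3 ∣ toℕ a → sum (map (isMultipleOf3 ∘ toℕ) (0ᶻ ∷ a ∷ - a ∷ [])) ≡ 1
  multiplesOf3-0±a a 3∤a = cong₂ ℕ._+_ (cong isZero residue-0)
    (trans (cong (λ r → isZero (residue a) ℕ.+ (isZero r ℕ.+ 0)) (residue-neg a))
           (multiplesOf3In±-nonzero (residue a) (m%n<n (toℕ a) 3) (3∤a ∘ m%n≡0⇒n∣m (toℕ a) 3)))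

  module _ {α β : Zv} (A : APS α β) (4N+3≡v : 4 ℕ.* ((v ∸ 3) / 4) ℕ.+ 3 ≡ v)
           (3∤α : ¬ 3 ∣ toℕ α) (3∤β : ¬ 3 ∣ toℕ β) where
    open APS A

    private
      N = (v ∸ 3) / 4

      x y : Fin N → Zv
      x i = proj₁ (S i)
      y i = proj₂ (S i)

      differences : Fin N → Zv × Zv
      differences i = x i -ᶻ y i , x i +ᶻ y i

      count : (Fin N → Zv × Zv) → ℕ
      count g = sum (map (sum± (isMultipleOf3 ∘ toℕ) ∘′ g) (allFin N))

      count+1≡ : ∀ g γ → ¬ 3 ∣ toℕ γ → (∀ z → z ≢ 0ᶻ × z ≢ γ × z ≢ - γ → Σ[ i ∈ Fin N ] z ∈± g i) →
                 ∀ {m} → v ≡ 3 ℕ.* m → count g ℕ.+ 1 ≡ m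
      count+1≡ g γ 3∤γ cover {m} v≡3m = begin
        count g ℕ.+ 1                                                              ≡⟨ cong (count g ℕ.+_) (multiplesOf3-0±a γ 3∤γ) ⟨
        count g ℕ.+ sum (map (isMultipleOf3 ∘ toℕ) (0ᶻ ∷ γ ∷ - γ ∷ []))             ≡⟨ sum-over-cover g 0ᶻ γ (- γ) 4N+3≡v cover _ ⟨
        sum (map (isMultipleOf3 ∘ toℕ) (allFin v))                                 ≡⟨ sum-allFin v isMultipleOf3 ⟩
        sumUpTo isMultipleOf3 v                                                    ≡⟨ cong (sumUpTo isMultipleOf3) v≡3m ⟩
        sumUpTo isMultipleOf3 (3 ℕ.* m)                                            ≡⟨ count-multiplesOf3 m ⟩
        m                                                                          ∎
        where open ≡-Reasoning

      pairCount : ∀ i → Σ[ e ∈ ℕ ] sum± (isMultipleOf3 ∘ toℕ) (S i) ℕ.+ sum± (isMultipleOf3 ∘ toℕ) (differences i) ≡ 2 ℕ.+ 6 ℕ.* e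
      pairCount i = subst (λ n → Σ[ e ∈ ℕ ] n ≡ 2 ℕ.+ 6 ℕ.* e)
        (sym (cong₂ ℕ._+_ (sum±-multiplesOf3 (x i) (y i)) (sum±-multiplesOf3-differences (x i) (y i))))
        (multiplesOf3In±-pairs (residue (x i)) (residue (y i)) (m%n<n (toℕ (x i)) 3) (m%n<n (toℕ (y i)) 3))

      count-both : count S ℕ.+ count differences ≡ 2 ℕ.* N ℕ.+ 6 ℕ.* sum (map (proj₁ ∘ pairCount) (allFin N))
      count-both = trans (sum-+-≡2+6* (sum± (isMultipleOf3 ∘ toℕ) ∘′ S) (sum± (isMultipleOf3 ∘ toℕ) ∘′ differences) (proj₁ ∘ pairCount) (allFin N) (proj₂ ∘ pairCount))
        (cong (λ n → 2 ℕ.* n ℕ.+ 6 ℕ.* sum (map (proj₁ ∘ pairCount) (allFin N))) (Listₚ.length-tabulate {n = N} (λ i → i)))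

    APS⇒≡1[mod12] : ∀ m → v ≡ 3 ℕ.* m → m % 12 ≡ 1
    APS⇒≡1[mod12] m v≡3m = counts⇒≡1[mod12] m (count S) (count differences) N (sum (map (proj₁ ∘ pairCount) (allFin N)))
      (count+1≡ S α 3∤α cover₁' v≡3m) (count+1≡ differences β 3∤β cover₂' v≡3m) count-both (trans 4N+3≡v v≡3m)

prime[3] : Prime 3
prime[3] = toWitness {a? = prime? 3} tt

3∤2 : ¬ 3 ∣ 2
3∤2 3∣2 with ∣⇒≤ 3∣2
... | s≤s (s≤s ())

3∣2*⇒3∣ : ∀ w → 3 ∣ 2 ℕ.* w → 3 ∣ w
3∣2*⇒3∣ w 3∣2w with euclidsLemma 2 w prime[3] 3∣2w
... | inj₁ 3∣2 = ⊥-elim (3∤2 3∣2)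
... | inj₂ 3∣w = 3∣w

private
  squares-mod3 : ∀ r s → r < 3 → s < 3 → ((r ℕ.* r) % 3 ℕ.+ (s ℕ.* s) % 3) % 3 ≡ 0 → r ≡ 0 × s ≡ 0
  squares-mod3 0 0 _ _ _ = refl , refl
  squares-mod3 0 1 _ _ ()
  squares-mod3 0 2 _ _ ()
  squares-mod3 1 0 _ _ ()
  squares-mod3 1 1 _ _ ()
  squares-mod3 1 2 _ _ ()
  squares-mod3 2 0 _ _ ()
  squares-mod3 2 1 _ _ ()
  squares-mod3 2 2 _ _ ()
  squares-mod3 (suc (suc (suc _))) _ (s≤s (s≤s (s≤s ()))) _ _
  squares-mod3 0 (suc (suc (suc _))) _ (s≤s (s≤s (s≤s ()))) _
  squares-mod3 1 (suc (suc (suc _))) _ (s≤s (s≤s (s≤s ()))) _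
  squares-mod3 2 (suc (suc (suc _))) _ (s≤s (s≤s (s≤s ()))) _

3∣sum-of-squares⇒3∣both : ∀ x y → 3 ∣ x ℕ.* x ℕ.+ y ℕ.* y → 3 ∣ x × 3 ∣ y
3∣sum-of-squares⇒3∣both x y 3∣x²+y² with squares-mod3 (x % 3) (y % 3) (m%n<n x 3) (m%n<n y 3) residues≡0
  where
  residues≡0 : ((x % 3 ℕ.* (x % 3)) % 3 ℕ.+ (y % 3 ℕ.* (y % 3)) % 3) % 3 ≡ 0
  residues≡0 = begin
    ((x % 3 ℕ.* (x % 3)) % 3 ℕ.+ (y % 3 ℕ.* (y % 3)) % 3) % 3  ≡⟨ cong₂ (λ a b → (a ℕ.+ b) % 3) (%-distribˡ-* x x 3) (%-distribˡ-* y y 3) ⟨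
    ((x ℕ.* x) % 3 ℕ.+ (y ℕ.* y) % 3) % 3                    ≡⟨ %-distribˡ-+ (x ℕ.* x) (y ℕ.* y) 3 ⟨
    (x ℕ.* x ℕ.+ y ℕ.* y) % 3                                ≡⟨ n∣m⇒m%n≡0 _ 3 3∣x²+y² ⟩
    0                                                        ∎
    where open ≡-Reasoning
... | x%3≡0 , y%3≡0 = m%n≡0⇒n∣m x 3 x%3≡0 , m%n≡0⇒n∣m y 3 y%3≡0

-- The congruence S + 2y² ≡ 4x² of case (1), with S ≡ 2m (mod v) for v = 3m = 9^(k+1) w,
-- read modulo 9^(k+1).
ThreeAdicCongruence : ℕ → ℕ → ℕ → ℕ → Set
ThreeAdicCongruence k w x y =
  Congruence._≈_ (9 ^ suc k) (+ 2 * + (3 ℕ.* 9 ^ k ℕ.* w) + + 2 * (+ y * + y)) (+ 4 * (+ x * + x))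

ThreeAdicCongruence⇒3∣both : ∀ k w x y → ThreeAdicCongruence k w x y → 3 ∣ x × 3 ∣ y
ThreeAdicCongruence⇒3∣both k w x y ≈[9^k+1] = 3∣sum-of-squares⇒3∣both x y (≈0⇒∣ (*-cancelʳ-≈ 2 3∤2 2[x²+y²]≈0))
  where
  open Congruence 3
  open PrimeModulus 3 prime[3] using (*-cancelʳ-≈)
  X = + x
  Y = + y
  W = + (3 ℕ.* 9 ^ k ℕ.* w)
  W≈0 : W ≈ + 0
  W≈0 = ∣⇒≈0 (ℕ∣.∣m⇒∣m*n w (ℕ∣.∣m⇒∣m*n (9 ^ k) ℕ∣.∣-refl))
  3≈0 : + 3 ≈ + 0
  3≈0 = ∣⇒≈0 ℕ∣.∣-refl
  ≈[3] : + 2 * W + + 2 * (Y * Y) ≈ + 4 * (X * X)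
  ≈[3] = ≈-mod-∣ (ℕ∣.∣m⇒∣m*n (9 ^ k) (divides 3 refl)) ≈[9^k+1]
  2[x²+y²]≈0 : + (x ℕ.* x ℕ.+ y ℕ.* y) * + 2 ≈ + 0 * + 2
  2[x²+y²]≈0 = begin
    + (x ℕ.* x ℕ.+ y ℕ.* y) * + 2             ≡⟨ cong (_* + 2) (trans (ℤₚ.pos-+ (x ℕ.* x) _) (cong₂ _+_ (ℤₚ.pos-* x x) (ℤₚ.pos-* y y))) ⟩
    (X * X + Y * Y) * + 2                     ≡⟨ lemma₁ X Y ⟩
    + 2 * (X * X) + (+ 2 * + 0 + + 2 * (Y * Y)) ≈⟨ +-congˡ (+ 2 * (X * X)) (+-congʳ (+ 2 * (Y * Y)) (*-congˡ (+ 2) W≈0)) ⟨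
    + 2 * (X * X) + (+ 2 * W + + 2 * (Y * Y))   ≈⟨ +-congˡ (+ 2 * (X * X)) ≈[3] ⟩
    + 2 * (X * X) + + 4 * (X * X)             ≡⟨ lemma₂ X ⟩
    + 2 * (X * X) * + 3                       ≈⟨ *-congˡ (+ 2 * (X * X)) 3≈0 ⟩
    + 2 * (X * X) * + 0                       ≡⟨ lemma₃ X ⟩
    + 0 * + 2                                 ∎
    where
    lemma₁ : ∀ X Y → (X * X + Y * Y) * + 2 ≡ + 2 * (X * X) + (+ 2 * + 0 + + 2 * (Y * Y))
    lemma₁ = solve-∀
    lemma₂ : ∀ X → + 2 * (X * X) + + 4 * (X * X) ≡ + 2 * (X * X) * + 3
    lemma₂ = solve-∀
    open ≈-Reasoning
    lemma₃ : ∀ X → + 2 * (X * X) * + 0 ≡ + 0 * + 2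
    lemma₃ = solve-∀

private
  ThreeAdicCongruence-base : ∀ w x y → ThreeAdicCongruence 0 w (x ℕ.* 3) (y ℕ.* 3) → 3 ∣ w
  ThreeAdicCongruence-base w x y ≈[9] = 3∣2*⇒3∣ w (ℕ∣.*-cancelˡ-∣ 3 (subst (9 ∣_) (ℕₚ.*-assoc 3 2 w) (≈0⇒∣ (begin
    + (6 ℕ.* w)                                                  ≡⟨ ℤₚ.pos-* 6 w ⟩
    + 6 * W                                                      ≡⟨ lemma X Y W ⟩
    (lhs′ - rhs′) + + 9 * (+ 4 * (X * X) - + 2 * (Y * Y))        ≡⟨ cong (λ d → d + + 9 * (+ 4 * (X * X) - + 2 * (Y * Y))) (cong₂ _-_ lhs≡ rhs≡) ⟨
    (lhs - rhs) + + 9 * (+ 4 * (X * X) - + 2 * (Y * Y))          ≈⟨ +-cong (≈⇒-≈0 ≈[9]) (n*≈0 _) ⟩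
    + 0 + + 0                                                    ≡⟨⟩
    + 0                                                          ∎))))
    where
    open Congruence 9
    open ≈-Reasoning
    X = + x
    Y = + y
    W = + w
    lhs = + 2 * + (3 ℕ.* 1 ℕ.* w) + + 2 * (+ (y ℕ.* 3) * + (y ℕ.* 3))
    rhs = + 4 * (+ (x ℕ.* 3) * + (x ℕ.* 3))
    lhs′ = + 2 * (+ 3 * W) + + 2 * ((Y * + 3) * (Y * + 3))
    rhs′ = + 4 * ((X * + 3) * (X * + 3))
    lhs≡ : lhs ≡ lhs′
    lhs≡ = cong₂ (λ a b → + 2 * a + + 2 * (b * b)) (trans (cong (λ c → + (c ℕ.* w)) (ℕₚ.*-identityʳ 3)) (ℤₚ.pos-* 3 w)) (ℤₚ.pos-* y 3)
    rhs≡ : rhs ≡ rhs′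
    rhs≡ = cong (λ a → + 4 * (a * a)) (ℤₚ.pos-* x 3)
    lemma : ∀ X Y W → + 6 * W ≡ (+ 2 * (+ 3 * W) + + 2 * ((Y * + 3) * (Y * + 3)) - + 4 * ((X * + 3) * (X * + 3)))
                                 + + 9 * (+ 4 * (X * X) - + 2 * (Y * Y))
    lemma = solve-∀

  ThreeAdicCongruence-÷9 : ∀ k w x y → ThreeAdicCongruence (suc k) w (x ℕ.* 3) (y ℕ.* 3) → ThreeAdicCongruence k w x y
  ThreeAdicCongruence-÷9 k w x y ≈[9^k+2] = ≈-cancel-scale 9 {9 ^ suc k} (subst₂ (Congruence._≈_ (9 ^ suc (suc k))) lhs≡ rhs≡ ≈[9^k+2])
    where
    T = + (3 ℕ.* 9 ^ k ℕ.* w)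
    9T≡ : + (3 ℕ.* 9 ^ suc k ℕ.* w) ≡ + 9 * T
    9T≡ = trans (cong +_ (lemma (9 ^ k) w)) (ℤₚ.pos-* 9 (3 ℕ.* 9 ^ k ℕ.* w))
      where lemma : ∀ u w → 3 ℕ.* (9 ℕ.* u) ℕ.* w ≡ 9 ℕ.* (3 ℕ.* u ℕ.* w)
            lemma = ℕ-Solver.solve-∀
    lemmaˡ : ∀ T Y → + 2 * (+ 9 * T) + + 2 * ((Y * + 3) * (Y * + 3)) ≡ + 9 * (+ 2 * T + + 2 * (Y * Y))
    lemmaˡ = solve-∀
    lemmaʳ : ∀ X → + 4 * ((X * + 3) * (X * + 3)) ≡ + 9 * (+ 4 * (X * X))
    lemmaʳ = solve-∀
    lhs≡ : + 2 * + (3 ℕ.* 9 ^ suc k ℕ.* w) + + 2 * (+ (y ℕ.* 3) * + (y ℕ.* 3)) ≡ + 9 * (+ 2 * T + + 2 * (+ y * + y))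
    lhs≡ = trans (cong₂ (λ a b → + 2 * a + + 2 * (b * b)) 9T≡ (ℤₚ.pos-* y 3)) (lemmaˡ T (+ y))
    rhs≡ : + 4 * (+ (x ℕ.* 3) * + (x ℕ.* 3)) ≡ + 9 * (+ 4 * (+ x * + x))
    rhs≡ = trans (cong (λ a → + 4 * (a * a)) (ℤₚ.pos-* x 3)) (lemmaʳ (+ x))

-- Modulo 3 the congruence forces 3 ∣ x and 3 ∣ y; dividing them by 3 divides it by 9, lowering k.
ThreeAdicCongruence⇒3∣w : ∀ k w x y → ThreeAdicCongruence k w x y → 3 ∣ w
ThreeAdicCongruence-thirds⇒3∣w : ∀ k w x y → ThreeAdicCongruence k w (x ℕ.* 3) (y ℕ.* 3) → 3 ∣ w

ThreeAdicCongruence⇒3∣w k w x y ≈[9^k+1] = ThreeAdicCongruence-thirds⇒3∣w k w (quotient 3∣x) (quotient 3∣y)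
  (subst₂ (ThreeAdicCongruence k w) (_∣_.equality 3∣x) (_∣_.equality 3∣y) ≈[9^k+1])
  where
  3∣x = proj₁ (ThreeAdicCongruence⇒3∣both k w x y ≈[9^k+1])
  3∣y = proj₂ (ThreeAdicCongruence⇒3∣both k w x y ≈[9^k+1])

ThreeAdicCongruence-thirds⇒3∣w zero    w x y = ThreeAdicCongruence-base w x y
ThreeAdicCongruence-thirds⇒3∣w (suc k) w x y = ThreeAdicCongruence⇒3∣w k w x y ∘ ThreeAdicCongruence-÷9 k w x y

∈⇒∣product : ∀ {p} ps → p ∈ ps → p ∣ product ps
∈⇒∣product (q ∷ ps) (here refl) = ℕ∣.m∣m*n (product ps)
∈⇒∣product (q ∷ ps) (there p∈) = ℕ∣.∣n⇒∣m*n q (∈⇒∣product ps p∈)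

prime∣prime⇒≡ : ∀ {p q} → Prime p → Prime q → p ∣ q → p ≡ q
prime∣prime⇒≡ p-prime q-prime p∣q with prime⇒irreducible q-prime p∣q
... | inj₁ refl = ⊥-elim (¬prime[1] p-prime)
... | inj₂ p≡q  = p≡q

prime∣product⇒∈ : ∀ {p} ps → Prime p → All Prime ps → p ∣ product ps → p ∈ ps
prime∣product⇒∈ []       p-prime _ p∣1 = ⊥-elim (¬prime[1] (subst Prime (ℕ∣.∣1⇒≡1 p∣1) p-prime))
prime∣product⇒∈ (q ∷ ps) p-prime (q-prime ∷ ps-prime) p∣ with euclidsLemma q (product ps) p-prime p∣
... | inj₁ p∣q  = here (prime∣prime⇒≡ p-prime q-prime p∣q)
... | inj₂ p∣ps = there (prime∣product⇒∈ ps p-prime ps-prime p∣ps)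

product∣ : ∀ ps {a} → Unique ps → All Prime ps → (∀ {p} → p ∈ ps → p ∣ a) → product ps ∣ a
product∣ []       _ _ _ = ℕ∣.1∣ _
product∣ (p ∷ ps) (p∉ps ∷ ps!) (p-prime ∷ ps-prime) ps∣a with product∣ ps ps! ps-prime (ps∣a ∘ there)
... | divides k a≡k*ps with euclidsLemma k (product ps) p-prime (subst (p ∣_) a≡k*ps (ps∣a (here refl)))
...   | inj₁ (divides j refl) = divides j (trans a≡k*ps (ℕₚ.*-assoc j p (product ps)))
...   | inj₂ p∣ps = ⊥-elim (All.lookup p∉ps (prime∣product⇒∈ ps p-prime ps-prime p∣ps) refl)

4*[v∸3]/4+3≡v : ∀ v → v % 4 ≡ 3 → 4 ℕ.* ((v ∸ 3) / 4) ℕ.+ 3 ≡ v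
4*[v∸3]/4+3≡v v v%4≡3 = trans (cong (λ z → 4 ℕ.* z ℕ.+ 3) [v∸3]/4≡v/4) (trans (lemma (v / 4)) (sym v≡3+[v/4]*4))
  where
  v≡3+[v/4]*4 : v ≡ 3 ℕ.+ (v / 4) ℕ.* 4
  v≡3+[v/4]*4 = trans (m≡m%n+[m/n]*n v 4) (cong (ℕ._+ (v / 4) ℕ.* 4) v%4≡3)
  [v∸3]/4≡v/4 : (v ∸ 3) / 4 ≡ v / 4
  [v∸3]/4≡v/4 = trans (cong (λ z → (z ∸ 3) / 4) v≡3+[v/4]*4)
                      (trans (cong (_/ 4) (ℕₚ.m+n∸m≡n 3 ((v / 4) ℕ.* 4))) (m*n/n≡m (v / 4) 4))
  lemma : ∀ k → 4 ℕ.* k ℕ.+ 3 ≡ 3 ℕ.+ k ℕ.* 4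
  lemma = ℕ-Solver.solve-∀

module _ {v : ℕ} .{{_ : NonZero v}} {α β : Zmod.Zv v} (A : Zmod.APS v α β) (4N+3≡v : 4 ℕ.* ((v ∸ 3) / 4) ℕ.+ 3 ≡ v) where
  open SquareSums v using (sumOfSquares; APS⇒sumOfSquares≈)

  private
    a = toℕ α
    b = toℕ β

  -- Modulo p the sum of squares is 0, so β² ≡ 2α², and 2 is not a square modulo p.
  APS⇒prime∣both : ∀ {p} → Prime p → p ∣ v → PlusMinus3Mod8 p → p ≢ 3 → p ∣ a × p ∣ b
  APS⇒prime∣both {p} p-prime p∣v p≡±3 p≢3 = p∣a , square∣⇒∣ (≈0⇒∣ b²≈0)
    where
    open Congruence p
    open PrimeModulus p p-prime
    open ≈-Reasoning
    square∣⇒∣ : ∀ {x} → p ∣ x ℕ.* x → p ∣ x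
    square∣⇒∣ {x} p∣x² with euclidsLemma x x p-prime p∣x²
    ... | inj₁ p∣x = p∣x
    ... | inj₂ p∣x = p∣x
    p∤12 : ¬ p ∣ 12
    p∤12 p∣12 with euclidsLemma 3 4 p-prime p∣12
    ... | inj₁ p∣3 = p≢3 (prime∣prime⇒≡ p-prime prime[3] p∣3)
    ... | inj₂ p∣4 with euclidsLemma 2 2 p-prime p∣4
    ...   | inj₁ p∣2 = PlusMinus3Mod8⇒∤2 p≡±3 p∣2
    ...   | inj₂ p∣2 = PlusMinus3Mod8⇒∤2 p≡±3 p∣2
    6*sumOfSquares≈0 : + 6 * + sumOfSquares ≈ + 0
    6*sumOfSquares≈0 = subst (_≈ + 0) (ℤₚ.pos-* 6 sumOfSquares)
      (∣⇒≈0 (ℕ∣.∣-trans p∣v (subst (v ∣_) (cong (6 ℕ.*_) (sym (sum-allFin v (λ k → k ℕ.* k)))) (n∣6*sumUpTo-squares v))))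
    b²≈2a² : + (b ℕ.* b) ≈ + (2 ℕ.* (a ℕ.* a))
    b²≈2a² = *-cancelʳ-≈ 12 p∤12 (begin
      + (b ℕ.* b) * + 12                                                 ≡⟨ cong (_* + 12) (ℤₚ.pos-* b b) ⟩
      (+ b * + b) * + 12                                                 ≡⟨ lemma₁ (+ sumOfSquares) (+ b * + b) ⟩
      + 6 * (+ sumOfSquares + + 2 * (+ b * + b)) + ℤ.- (+ 6 * + sumOfSquares)
        ≈⟨ +-cong (*-congˡ (+ 6) (≈-mod-∣ p∣v (APS⇒sumOfSquares≈ A 4N+3≡v))) (-‿cong 6*sumOfSquares≈0) ⟩
      + 6 * (+ 4 * (+ a * + a)) + ℤ.- + 0                               ≡⟨ lemma₂ (+ a * + a) ⟩
      (+ 2 * (+ a * + a)) * + 12                                         ≡⟨ cong (λ x → + 2 * x * + 12) (ℤₚ.pos-* a a) ⟨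
      (+ 2 * + (a ℕ.* a)) * + 12                                         ≡⟨ cong (_* + 12) (ℤₚ.pos-* 2 (a ℕ.* a)) ⟨
      + (2 ℕ.* (a ℕ.* a)) * + 12                                         ∎)
      where
      lemma₁ : ∀ T B → B * + 12 ≡ + 6 * (T + + 2 * B) + ℤ.- (+ 6 * T)
      lemma₁ = solve-∀
      lemma₂ : ∀ A → + 6 * (+ 4 * A) + ℤ.- + 0 ≡ (+ 2 * A) * + 12
      lemma₂ = solve-∀
    p∣a : p ∣ a
    p∣a = square≈2*square⇒∣ p≡±3 a b b²≈2a²
    b²≈0 : + (b ℕ.* b) ≈ + 0
    b²≈0 = begin
      + (b ℕ.* b)               ≈⟨ b²≈2a² ⟩
      + (2 ℕ.* (a ℕ.* a))       ≡⟨ trans (ℤₚ.pos-* 2 (a ℕ.* a)) (cong (+ 2 *_) (ℤₚ.pos-* a a)) ⟩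
      + 2 * (+ a * + a)         ≈⟨ *-congˡ (+ 2) (*-cong (∣⇒≈0 p∣a) (∣⇒≈0 p∣a)) ⟩
      + 0                       ∎

%-reduce : ∀ m n o .{{_ : NonZero m}} .{{_ : NonZero n}} → m ∣ n → ∀ {r} → o % n ≡ r → o % m ≡ r % m
%-reduce m n o m∣n o%n≡r = trans (sym (m∣n⇒o%n%m≡o%m m n o m∣n)) (cong (_% m) o%n≡r)

%12≡7∨11⇒%4≡3 : ∀ v → v % 12 ≡ 7 ⊎ v % 12 ≡ 11 → v % 4 ≡ 3
%12≡7∨11⇒%4≡3 v (inj₁ v%12≡7)  = %-reduce 4 12 v (divides 3 refl) v%12≡7
%12≡7∨11⇒%4≡3 v (inj₂ v%12≡11) = %-reduce 4 12 v (divides 3 refl) v%12≡11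

%12≡7∨11⇒3∤ : ∀ v → v % 12 ≡ 7 ⊎ v % 12 ≡ 11 → ¬ 3 ∣ v
%12≡7∨11⇒3∤ v (inj₁ v%12≡7)  3∣v = ℕₚ.1+n≢0 (trans (sym (%-reduce 3 12 v (divides 4 refl) v%12≡7)) (n∣m⇒m%n≡0 v 3 3∣v))
%12≡7∨11⇒3∤ v (inj₂ v%12≡11) 3∣v = ℕₚ.1+n≢0 (trans (sym (%-reduce 3 12 v (divides 4 refl) v%12≡11)) (n∣m⇒m%n≡0 v 3 3∣v))

multiple<3*⇒3∤ : ∀ {P x} → ¬ 3 ∣ P → P ∣ x → x ≢ 0 → x < 3 ℕ.* P → ¬ 3 ∣ x
multiple<3*⇒3∤ {P} 3∤P (divides k refl) x≢0 x<3P 3∣kP with euclidsLemma k P prime[3] 3∣kP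
... | inj₂ 3∣P = 3∤P 3∣P
... | inj₁ (divides zero refl)    = x≢0 refl
... | inj₁ (divides (suc j) refl) = ℕₚ.<⇒≱ x<3P (subst (3 ℕ.* P ≤_) (sym (ℕₚ.*-assoc (suc j) 3 P)) (ℕₚ.m≤m+n (3 ℕ.* P) _))

module _ {v : ℕ} .{{_ : NonZero v}} where

  open Zmod v

  private
    toℕ≢0 : ∀ {α : Zv} → α ≢ 0ᶻ → toℕ α ≢ 0
    toℕ≢0 {α} α≢0 toℕα≡0 = α≢0 (Finₚ.toℕ-injective (trans toℕα≡0 (sym toℕ0ᶻ≡0)))
      where toℕ0ᶻ≡0 : toℕ 0ᶻ ≡ 0
            toℕ0ᶻ≡0 = trans (ResidueSums.toℕ-ι v 0) (m<n⇒m%n≡m (ℕ.>-nonZero⁻¹ v))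

  Case3⇒¬APS : Case3 v → ∀ {α β} → α ≢ 0ᶻ → ¬ APS α β
  Case3⇒¬APS (v%12≡7∨11 , ps , (ps! , ps-prime , ps≡±3) , v≡ps) {α} α≢0 A =
    toℕ≢0 α≢0 (∣∧<⇒≡0 v∣α (Finₚ.toℕ<n α))
    where
    ps∣α : ∀ {p} → p ∈ ps → p ∣ toℕ α
    ps∣α {p} p∈ps = proj₁ (APS⇒prime∣both A (4*[v∸3]/4+3≡v v (%12≡7∨11⇒%4≡3 v v%12≡7∨11))
      (All.lookup ps-prime p∈ps) p∣v (All.lookup ps≡±3 p∈ps) (λ { refl → %12≡7∨11⇒3∤ v v%12≡7∨11 p∣v }))
      where p∣v = subst (p ∣_) (sym v≡ps) (∈⇒∣product ps p∈ps)
    v∣α : v ∣ toℕ α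
    v∣α = subst (_∣ toℕ α) (sym v≡ps) (product∣ ps ps! ps-prime ps∣α)

  -- The primes force α and β to be multiples of P = v / 3 below 3P, hence prime to 3;
  -- counting multiples of 3 then gives P ≡ 1 (mod 12).
  Case2⇒¬APS : Case2 v → ∀ {α β} → α ≢ 0ᶻ → β ≢ 0ᶻ → ¬ APS α β
  Case2⇒¬APS (v%36≡15 , ps , (ps! , ps-prime , ps≡±3) , v≡3P) {α} {β} α≢0 β≢0 A = 5≢1 (trans (sym P%12≡5) P%12≡1)
    where
    5≢1 : 5 ≢ 1
    5≢1 ()
    P = product ps
    P≡5+12q : P ≡ 5 ℕ.+ (v / 36) ℕ.* 12
    P≡5+12q = ℕₚ.*-cancelˡ-≡ P _ 3 (trans (sym v≡3P)
      (trans (m≡m%n+[m/n]*n v 36) (trans (cong (ℕ._+ (v / 36) ℕ.* 36) v%36≡15) (lemma (v / 36)))))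
      where lemma : ∀ q → 15 ℕ.+ q ℕ.* 36 ≡ 3 ℕ.* (5 ℕ.+ q ℕ.* 12)
            lemma = ℕ-Solver.solve-∀
    P%12≡5 : P % 12 ≡ 5
    P%12≡5 = trans (cong (_% 12) P≡5+12q) ([m+kn]%n≡m%n 5 (v / 36) 12)
    3∤P : ¬ 3 ∣ P
    3∤P 3∣P = ℕₚ.1+n≢0 (trans (sym (%-reduce 3 12 P (divides 4 refl) P%12≡5)) (n∣m⇒m%n≡0 P 3 3∣P))
    4N+3≡v : 4 ℕ.* ((v ∸ 3) / 4) ℕ.+ 3 ≡ v
    4N+3≡v = 4*[v∸3]/4+3≡v v (%-reduce 4 36 v (divides 9 refl) v%36≡15)
    ps∣both : ∀ {p} → p ∈ ps → p ∣ toℕ α × p ∣ toℕ β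
    ps∣both {p} p∈ps = APS⇒prime∣both A 4N+3≡v (All.lookup ps-prime p∈ps)
      (subst (p ∣_) (sym v≡3P) (ℕ∣.∣n⇒∣m*n 3 (∈⇒∣product ps p∈ps))) (All.lookup ps≡±3 p∈ps)
      (λ { refl → 3∤P (∈⇒∣product ps p∈ps) })
    3∤α : ¬ 3 ∣ toℕ α
    3∤α = multiple<3*⇒3∤ 3∤P (product∣ ps ps! ps-prime (proj₁ ∘ ps∣both)) (toℕ≢0 α≢0)
                         (subst (toℕ α <_) v≡3P (Finₚ.toℕ<n α))
    3∤β : ¬ 3 ∣ toℕ β
    3∤β = multiple<3*⇒3∤ 3∤P (product∣ ps ps! ps-prime (proj₂ ∘ ps∣both)) (toℕ≢0 β≢0)
                         (subst (toℕ β <_) v≡3P (Finₚ.toℕ<n β))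
    P%12≡1 : P % 12 ≡ 1
    P%12≡1 = ResiduesMod3.APS⇒≡1[mod12] v (divides P (trans v≡3P (ℕₚ.*-comm 3 P))) A 4N+3≡v 3∤α 3∤β P v≡3P

  Case1⇒¬APS : Case1 v → ∀ {α β} → ¬ APS α β
  Case1⇒¬APS (_ , zero , _ , () , _)
  Case1⇒¬APS (v%12≡3 , suc k , v₁ , _ , 3∤v₁ , v≡3^[2k+2]v₁) {α} {β} A =
    3∤v₁ (ThreeAdicCongruence⇒3∣w k v₁ (toℕ α) (toℕ β) ≈[9^k+1])
    where
    open SquareSums v using (APS⇒sumOfSquares≈; sumOfSquares≈2*[4q+1]; toℤ²)
    open Congruence v
    q = v / 12
    m = 4 ℕ.* q ℕ.+ 1
    v≡3+12q : v ≡ 3 ℕ.+ q ℕ.* 12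
    v≡3+12q = trans (m≡m%n+[m/n]*n v 12) (cong (ℕ._+ q ℕ.* 12) v%12≡3)
    v≡9^[k+1]v₁ : v ≡ 9 ^ suc k ℕ.* v₁
    v≡9^[k+1]v₁ = trans v≡3^[2k+2]v₁ (cong (ℕ._* v₁) (sym (ℕₚ.^-*-assoc 3 2 (suc k))))
    m≡3*9^k*v₁ : m ≡ 3 ℕ.* 9 ^ k ℕ.* v₁
    m≡3*9^k*v₁ = ℕₚ.*-cancelˡ-≡ m _ 3 (trans (sym (trans v≡3+12q (lemma₁ q))) (trans v≡9^[k+1]v₁ (lemma₂ (9 ^ k) v₁)))
      where lemma₁ : ∀ q → 3 ℕ.+ q ℕ.* 12 ≡ 3 ℕ.* (4 ℕ.* q ℕ.+ 1)
            lemma₁ = ℕ-Solver.solve-∀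
            lemma₂ : ∀ u w → 9 ℕ.* u ℕ.* w ≡ 3 ℕ.* (3 ℕ.* u ℕ.* w)
            lemma₂ = ℕ-Solver.solve-∀
    ≈[v] : + 2 * + m + + 2 * toℤ² β ≈ + 4 * toℤ² α
    ≈[v] = ≈-trans (+-congʳ (+ 2 * toℤ² β) (≈-sym (sumOfSquares≈2*[4q+1] q v≡3+12q)))
                   (APS⇒sumOfSquares≈ A (4*[v∸3]/4+3≡v v (%-reduce 4 12 v (divides 3 refl) v%12≡3)))
    ≈[9^k+1] : ThreeAdicCongruence k v₁ (toℕ α) (toℕ β)
    ≈[9^k+1] = ≈-mod-∣ (divides v₁ (trans v≡9^[k+1]v₁ (ℕₚ.*-comm _ v₁)))
                       (subst (λ n → + 2 * + n + + 2 * toℤ² β ≈ + 4 * toℤ² α) m≡3*9^k*v₁ ≈[v])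

open Defs using (Zv; 0ᶻ; APS)

lemma3p3 : (v : ℕ) .{{_ : NonZero v}} → Case1 v ⊎ Case2 v ⊎ Case3 v →
  (α β : Zv v) → α ≢ 0ᶻ v → β ≢ 0ᶻ v → ¬ APS v α β
lemma3p3 v (inj₁ case1)        α β α≢0 β≢0 = Case1⇒¬APS case1
lemma3p3 v (inj₂ (inj₁ case2)) α β α≢0 β≢0 = Case2⇒¬APS case2 α≢0 β≢0
lemma3p3 v (inj₂ (inj₂ case3)) α β α≢0 β≢0 = Case3⇒¬APS case3 α≢0
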